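{- Let $\alpha\vDash n$. Then \[\mathcal H\mathfrak S^*_\alpha(X,Y)=\sum_S\tilde Q_{\mathrm{comp}(\mathrm{Des}_{\mathfrak S^*}(S))}(X,Y),\] where the sum is over all standard immaculate tableaux $S$ of shape $\alpha$.
   Context: Let $\mathcal A=\{1,\dots,\ell\}$ and $\mathcal A'=\{1',\dots,k'\}$ with total order $1<2<\dots<\ell<1'<2'<\dots<k'$, and variables $X=(x_1,\dots,x_\ell)$, $Y=(y_1,\dots,y_k)$, with $z_i=x_i$ for $i\in\mathcal A$ and $z_{i'}=y_i$. A semistandard hook immaculate tableau of shape $\alpha$ is a filling of the diagram of $\alpha$ ($\alpha_i$ left-justified boxes in row $i$, row 1 at bottom) with entries in $\mathcal A\cup\mathcal A'$ such that the first column increases bottom to top, strictly for entries in $\mathcal A$ and weakly for entries in $\mathcal A'$, and each row increases left to right, weakly for entries in $\mathcal A$ and strictly for entries in $\mathcal A'$. The hook dual immaculate function is $\mathcal H\mathfrak S^*_\alpha(X,Y)=\sum_T\prod_{a\in\mathcal A\cup\mathcal A'}z_a^{\#\{a\text{'s in }T\}}$ over all such $T$. For $\beta\vDash n$, $\tilde Q_\beta(X,Y)=\sum z_{a_1}\cdots z_{a_n}$ over $a_1\le\dots\le a_n$ in $\mathcal A\cup\mathcal A'$ such that $a_i=a_{i+1}\in\mathcal A\Rightarrow i\notin\mathrm{set}(\beta)$ and $a_i=a_{i+1}\in\mathcal A'\Rightarrow i\in\mathrm{set}(\beta)$, where $\mathrm{set}(\beta)=\{\beta_1,\beta_1+\beta_2,\dots,\beta_1+\dots+\beta_{\ell(\beta)-1}\}$.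 A standard immaculate tableau of shape $\alpha$ is a filling with $1,\dots,n$ each once, leftmost column increasing bottom to top and rows increasing left to right; $\mathrm{Des}_{\mathfrak S^*}(S)=\{i: i+1\text{ is strictly above } i\text{ in }S\}$; $\mathrm{comp}$ is the inverse of $\mathrm{set}$. -}

module Defs where

open import Level using (Level)
open import Data.Bool using (Bool; true; false; _∧_; _∨_; not; if_then_else_)
open import Data.Nat using (ℕ; zero; suc; _+_; _∸_; _≡ᵇ_; _<ᵇ_)
open import Data.Fin using (Fin; toℕ)
open import Data.Sum using (_⊎_; inj₁; inj₂)
open import Data.List using (List; []; _∷_; _++_; map; concatMap; filter; foldr; length; upTo; allFin)
open import Data.Nat.ListAction using (sum)
open import Data.Product using (_×_; _,_)
open import Relation.Nullary.Decidable using (Dec; yes; no)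
open import Relation.Nullary using (does)
open import Relation.Binary.PropositionalEquality using (_≡_)
open import Algebra.Bundles using (CommutativeSemiring)

words : {A : Set} → List A → ℕ → List (List A)
words as zero    = [] ∷ []
words as (suc m) = concatMap (λ a → map (a ∷_) (words as m)) as

-- all fillings of the diagram of shape α (list of rows, row 1 first = bottom),
-- row i having α_i boxes, with entries from `as`
fillings : {A : Set} → List A → List ℕ → List (List (List A))
fillings as []      = [] ∷ []
fillings as (a ∷ α) =
  concatMap (λ r → map (r ∷_) (fillings as α)) (words as a)

consecutive : {A : Set} → (A → A → Bool) → List A → Bool
consecutive p []           = true
consecutive p (a ∷ [])     = true
consecutive p (a ∷ b ∷ as) = p a b ∧ consecutive p (b ∷ as)

firstColumn : {A : Set} → List (List A) → List A
firstColumn []             = []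
firstColumn ([] ∷ rs)      = firstColumn rs
firstColumn ((a ∷ _) ∷ rs) = a ∷ firstColumn rs

allB : {A : Set} → (A → Bool) → List A → Bool
allB p = foldr (λ a b → p a ∧ b) true

concatL : {A : Set} → List (List A) → List A
concatL = foldr _++_ []

data Positive : List ℕ → Set where
  []  : Positive []
  _∷_ : ∀ {a α} → 0 Data.Nat.< a → Positive α → Positive (a ∷ α)

_⊨_ : List ℕ → ℕ → Set
α ⊨ n = Positive α × (sum α ≡ n)

partialSums : ℕ → List ℕ → List ℕ
partialSums s []      = []
partialSums s (b ∷ []) = []
partialSums s (b ∷ c ∷ β) = (s + b) ∷ partialSums (s + b) (c ∷ β)

setC : List ℕ → List ℕ
setC = partialSums 0

-- comp n D : the composition of n whose set is D, for D = {d₁ < … < d_k} ⊆ [n-1]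
-- given as an increasing list: comp n D = (d₁, d₂-d₁, …, n-d_k)
compAux : ℕ → ℕ → List ℕ → List ℕ
compAux n prev []      = (n ∸ prev) ∷ []
compAux n prev (d ∷ D) = (d ∸ prev) ∷ compAux n d D

comp : ℕ → List ℕ → List ℕ
comp n D = compAux n 0 D

memℕ : ℕ → List ℕ → Bool
memℕ x = foldr (λ y b → (x ≡ᵇ y) ∨ b) false

-- The alphabet 𝒜 ∪ 𝒜' = {1,…,ℓ} ∪ {1',…,k'}, ordered 1<…<ℓ<1'<…<k'

Letter : ℕ → ℕ → Set
Letter ℓ k = Fin ℓ ⊎ Fin k

allLetters : (ℓ k : ℕ) → List (Letter ℓ k)
allLetters ℓ k = map inj₁ (allFin ℓ) ++ map inj₂ (allFin k)

_<L_ : ∀ {ℓ k} → Letter ℓ k → Letter ℓ k → Bool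
inj₁ i <L inj₁ j = toℕ i <ᵇ toℕ j
inj₁ i <L inj₂ j = true
inj₂ i <L inj₁ j = false
inj₂ i <L inj₂ j = toℕ i <ᵇ toℕ j

_=L_ : ∀ {ℓ k} → Letter ℓ k → Letter ℓ k → Bool
inj₁ i =L inj₁ j = toℕ i ≡ᵇ toℕ j
inj₁ i =L inj₂ j = false
inj₂ i =L inj₁ j = false
inj₂ i =L inj₂ j = toℕ i ≡ᵇ toℕ j

_≤L_ : ∀ {ℓ k} → Letter ℓ k → Letter ℓ k → Bool
a ≤L b = (a <L b) ∨ (a =L b)

unprimed : ∀ {ℓ k} → Letter ℓ k → Bool
unprimed (inj₁ _) = true
unprimed (inj₂ _) = false

primed : ∀ {ℓ k} → Letter ℓ k → Bool
primed a = not (unprimed a)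

colOK : ∀ {ℓ k} → Letter ℓ k → Letter ℓ k → Bool
colOK a b = (a <L b) ∨ ((a =L b) ∧ primed a)

rowOK : ∀ {ℓ k} → Letter ℓ k → Letter ℓ k → Bool
rowOK a b = (a <L b) ∨ ((a =L b) ∧ unprimed a)

isHookImmaculate : ∀ {ℓ k} → List (List (Letter ℓ k)) → Bool
isHookImmaculate T =
  consecutive colOK (firstColumn T) ∧ allB (consecutive rowOK) T

hookImmaculateTableaux : (ℓ k : ℕ) → List ℕ → List (List (List (Letter ℓ k)))
hookImmaculateTableaux ℓ k α =
  filter (λ T → isHookImmaculate T Data.Bool.≟ true) (fillings (allLetters ℓ k) α)

-- Evaluation in a commutative semiring (polynomial identities with ℕ
-- coefficients are exactly identities valid in every commutative semiring)

module Poly {c ℓ′ : Level} (R : CommutativeSemiring c ℓ′) where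
  open CommutativeSemiring R using (Carrier; 0#; 1#) renaming (_+_ to _⊕_; _*_ to _⊗_)

  module _ {ℓ k : ℕ} (x : Fin ℓ → Carrier) (y : Fin k → Carrier) where

    z : Letter ℓ k → Carrier
    z (inj₁ i) = x i
    z (inj₂ j) = y j

    Σ : {A : Set} → List A → (A → Carrier) → Carrier
    Σ as f = foldr (λ a s → f a ⊕ s) 0# as

    monomial : List (Letter ℓ k) → Carrier
    monomial = foldr (λ a p → z a ⊗ p) 1#

    HS : List ℕ → Carrier
    HS α = Σ (hookImmaculateTableaux ℓ k α) (λ T → monomial (concatL T))

    qCond : List ℕ → ℕ → List (Letter ℓ k) → Bool
    qCond S i []           = true
    qCond S i (a ∷ [])     = true
    qCond S i (a ∷ b ∷ as) =
      (a ≤L b)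
      ∧ not ((a =L b) ∧ unprimed a ∧ memℕ i S)
      ∧ not ((a =L b) ∧ primed a ∧ not (memℕ i S))
      ∧ qCond S (suc i) (b ∷ as)

    Qt : List ℕ → Carrier
    Qt β = Σ (filter (λ w → qCond (setC β) 1 w Data.Bool.≟ true)
                     (words (allLetters ℓ k) (sum β)))
             monomial

count : ℕ → List ℕ → ℕ
count v = foldr (λ w c → if v ≡ᵇ w then suc c else c) 0

oneTo : ℕ → List ℕ
oneTo n = map suc (upTo n)

isStandardImmaculate : ℕ → List (List ℕ) → Bool
isStandardImmaculate n S =
  allB (λ v → count v (concatL S) ≡ᵇ 1) (oneTo n)
  ∧ consecutive _<ᵇ_ (firstColumn S)
  ∧ allB (consecutive _<ᵇ_) S

standardImmaculateTableaux : List ℕ → List (List (List ℕ))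
standardImmaculateTableaux α =
  filter (λ S → isStandardImmaculate (sum α) S Data.Bool.≟ true)
         (fillings (oneTo (sum α)) α)

-- index (0-based, bottom row = 0) of the row containing v
rowOf : ℕ → List (List ℕ) → ℕ
rowOf v []       = 0
rowOf v (r ∷ rs) = if memℕ v r then 0 else suc (rowOf v rs)

DesS : ℕ → List (List ℕ) → List ℕ
DesS n S = filter (λ i → (rowOf i S <ᵇ rowOf (suc i) S) Data.Bool.≟ true)
                  (oneTo (n ∸ 1))

-- Give every cell of a hook tableau T its letter and its row, and list the cells in the total
-- order ⊑: by letter (1 < … < ℓ < 1′ < … < k′), equal unprimed letters from the top row down,
-- equal primed letters from the bottom row up.  Numbering the cells 1, …, n in this order turns
-- the shape into a standard immaculate tableau S (the first column of T increases, so row r is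
-- entered before row r + 1), and the letters read in this order form a word w.  A descent i of S
-- is a step up in rows from i to i + 1, so the conditions on rows and on the first column of T
-- say exactly that w is admissible for Q̃ of comp(Des S).  Conversely T is recovered from (S, w)
-- by writing w_i into the cell of S holding i.  The bijection preserves the monomial.

module Submission where

open import Defs
open import Level using (Level; 0ℓ)
open import Algebra.Bundles using (CommutativeMonoid; CommutativeSemiring)
open import Data.Bool using (Bool; true; false; _∧_; _∨_; not)
open import Data.Bool.Properties using (∨-zeroʳ)
import Data.Bool as Bool
open import Data.Nat using (ℕ; zero; suc; _+_; _∸_; _<_; _≤_; z≤n; s≤s; z<s; s<s; _≡ᵇ_; _<ᵇ_)
import Data.Nat as ℕ
open import Data.Nat.Properties
open import Data.Nat.ListAction using (sum)
open import Data.Fin using (Fin; toℕ)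
import Data.Fin as Fin
open import Data.Fin.Properties using (toℕ<n; toℕ-injective)
open import Data.Maybe using (just)
open import Data.Sum using (_⊎_; inj₁; inj₂)
import Data.Sum.Properties as ⊎
open import Data.Product using (_×_; _,_; proj₁; proj₂; ∃-syntax)
import Data.Product.Properties as ×
open import Data.Empty using (⊥; ⊥-elim)
open import Data.List using (List; []; _∷_; _++_; map; foldr; concatMap; concat; length; applyUpTo; filter; zip; head; allFin)
open import Data.List.Properties using (∷-injective; concat-map; foldr-map; filter-accept; filter-reject; length-map; length-++; map-++; filter-++; filter-all; filter-none; ++-identityʳ; map-applyUpTo; length-applyUpTo; map-∘; map-id)
open import Data.List.Membership.Propositional using (_∈_; _∉_; find; lose)
open import Data.List.Membership.Propositional.Properties using (∈-map⁺; ∈-map⁻; ∈-applyUpTo⁺; ∈-applyUpTo⁻; ∈-++⁺ˡ; ∈-++⁺ʳ; ∈-++⁻; ∈-filter⁺; ∈-filter⁻; ∈-allFin; ∈-concatMap⁺; ∈-concatMap⁻)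
open import Data.List.Membership.Propositional.Properties.WithK using (unique∧set⇒bag)
open import Data.List.Relation.Unary.Any using (here; there)
open import Data.List.Relation.Unary.All as All using (All; []; _∷_)
import Data.List.Relation.Unary.All.Properties as All
open import Data.List.Relation.Unary.AllPairs as AllPairs using (AllPairs; []; _∷_)
import Data.List.Relation.Unary.AllPairs.Properties as AllPairs
open import Data.List.Relation.Unary.Linked as Linked using (Linked; []; [-]; _∷_)
import Data.List.Relation.Unary.Linked.Properties as Linked
import Data.List.Relation.Unary.Sorted.TotalOrder.Properties as Sorted
open import Data.List.Relation.Binary.Pointwise using (Pointwise-≡⇒≡)
open import Data.List.Relation.Unary.Unique.Propositional using (Unique)
import Data.List.Relation.Unary.Unique.Propositional.Properties as Unique
open import Data.List.Relation.Binary.BagAndSetEquality using (∼bag⇒↭)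
open import Data.List.Relation.Binary.Permutation.Propositional using (_↭_; ↭-sym; ↭-trans; ↭-reflexive; prep; ↭⇒↭ₛ′; module PermutationReasoning)
import Data.List.Relation.Binary.Permutation.Propositional.Properties as ↭
import Data.List.Relation.Binary.Permutation.Setoid.Properties as ↭ₛ
open import Function using (_∘_; id; _on_)
open import Function.Bundles using (mk⇔)
open import Relation.Nullary using (¬_; Dec; yes; no)
open import Relation.Binary.Definitions using (tri<; tri≈; tri>)
open import Relation.Binary.Structures using (IsTotalOrder)
open import Relation.Binary.Bundles using (DecTotalOrder)
open import Relation.Binary.PropositionalEquality as ≡ using (_≡_; _≢_; refl; sym; trans; cong; cong₂; subst)

data Trichotomyᵇ (m n : ℕ) : Bool → Bool → Set where
  lt : m < n → Trichotomyᵇ m n true false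
  eq : m ≡ n → Trichotomyᵇ m n false true
  gt : n < m → Trichotomyᵇ m n false false

compareᵇ : ∀ m n → Trichotomyᵇ m n (m <ᵇ n) (m ≡ᵇ n)
compareᵇ zero    zero    = eq refl
compareᵇ zero    (suc n) = lt z<s
compareᵇ (suc m) zero    = gt z<s
compareᵇ (suc m) (suc n) with m <ᵇ n | m ≡ᵇ n | compareᵇ m n
... | _ | _ | lt m<n = lt (s<s m<n)
... | _ | _ | eq m≡n = eq (cong suc m≡n)
... | _ | _ | gt n<m = gt (s<s n<m)

trichotomyᵇ-+ˡ : ∀ l {m n x y} → Trichotomyᵇ m n x y → Trichotomyᵇ (l + m) (l + n) x y
trichotomyᵇ-+ˡ l (lt m<n) = lt (+-monoʳ-< l m<n)
trichotomyᵇ-+ˡ l (eq m≡n) = eq (cong (l +_) m≡n)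
trichotomyᵇ-+ˡ l (gt n<m) = gt (+-monoʳ-< l n<m)

<⇒<ᵇ≡true : ∀ {m n} → m < n → (m <ᵇ n) ≡ true
<⇒<ᵇ≡true {m} {n} m<n with m <ᵇ n | m ≡ᵇ n | compareᵇ m n
... | _ | _ | lt _   = refl
... | _ | _ | eq m≡n = ⊥-elim (<-irrefl m≡n m<n)
... | _ | _ | gt n<m = ⊥-elim (<-asym m<n n<m)

<ᵇ≡true⇒< : ∀ {m n} → (m <ᵇ n) ≡ true → m < n
<ᵇ≡true⇒< {m} {n} m<ᵇn with m <ᵇ n | m ≡ᵇ n | compareᵇ m n
... | _ | _ | lt m<n = m<n

≤⇒<ᵇ≡false : ∀ {m n} → n ≤ m → (m <ᵇ n) ≡ false
≤⇒<ᵇ≡false {m} {n} n≤m with m <ᵇ n | m ≡ᵇ n | compareᵇ m n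
... | _ | _ | lt m<n = ⊥-elim (<⇒≱ m<n n≤m)
... | _ | _ | eq _   = refl
... | _ | _ | gt _   = refl

≡ᵇ≡true⇒≡ : ∀ {m n} → (m ≡ᵇ n) ≡ true → m ≡ n
≡ᵇ≡true⇒≡ {m} {n} e with m <ᵇ n | m ≡ᵇ n | compareᵇ m n
... | _ | _ | eq m≡n = m≡n

≡ᵇ-refl : ∀ n → (n ≡ᵇ n) ≡ true
≡ᵇ-refl zero    = refl
≡ᵇ-refl (suc n) = ≡ᵇ-refl n

≢⇒≡ᵇ≡false : ∀ {m n} → m ≢ n → (m ≡ᵇ n) ≡ false
≢⇒≡ᵇ≡false {m} {n} m≢n with m <ᵇ n | m ≡ᵇ n | compareᵇ m n
... | _ | _ | lt _   = refl
... | _ | _ | eq m≡n = ⊥-elim (m≢n m≡n)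
... | _ | _ | gt _   = refl

true≢false : true ≢ false
true≢false ()

∧-true⁻ : ∀ {x y} → (x ∧ y) ≡ true → x ≡ true × y ≡ true
∧-true⁻ {true} {true} _ = refl , refl

∧-true⁺ : ∀ {x y} → x ≡ true → y ≡ true → (x ∧ y) ≡ true
∧-true⁺ refl refl = refl

module _ {A : Set} where

  consecutive⇒Linked : ∀ (p : A → A → Bool) xs → consecutive p xs ≡ true → Linked (λ a b → p a b ≡ true) xs
  consecutive⇒Linked p []           _  = []
  consecutive⇒Linked p (a ∷ [])     _  = [-]
  consecutive⇒Linked p (a ∷ b ∷ xs) ok = let pab , rest = ∧-true⁻ {p a b} ok in
                                         pab ∷ consecutive⇒Linked p (b ∷ xs) rest

  Linked⇒consecutive : ∀ (p : A → A → Bool) {xs} → Linked (λ a b → p a b ≡ true) xs → consecutive p xs ≡ true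
  Linked⇒consecutive p []          = refl
  Linked⇒consecutive p [-]         = refl
  Linked⇒consecutive p (pab ∷ rest) = ∧-true⁺ pab (Linked⇒consecutive p rest)

  allB⇒All : ∀ (p : A → Bool) xs → allB p xs ≡ true → All (λ a → p a ≡ true) xs
  allB⇒All p []       _  = []
  allB⇒All p (x ∷ xs) ok = let px , rest = ∧-true⁻ {p x} ok in px ∷ allB⇒All p xs rest

  All⇒allB : ∀ (p : A → Bool) {xs} → All (λ a → p a ≡ true) xs → allB p xs ≡ true
  All⇒allB p []          = refl
  All⇒allB p (px ∷ rest) = ∧-true⁺ px (All⇒allB p rest)

∈⇒memℕ≡true : ∀ {x xs} → x ∈ xs → memℕ x xs ≡ true
∈⇒memℕ≡true {x} {y ∷ xs} (here refl) rewrite ≡ᵇ-refl x = refl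
∈⇒memℕ≡true {x} {y ∷ xs} (there x∈xs) rewrite ∈⇒memℕ≡true x∈xs = ∨-zeroʳ (x ≡ᵇ y)

memℕ≡true⇒∈ : ∀ {x xs} → memℕ x xs ≡ true → x ∈ xs
memℕ≡true⇒∈ {x} {y ∷ xs} mem with x ≡ᵇ y in x≡ᵇy
... | true  = here (≡ᵇ≡true⇒≡ x≡ᵇy)
... | false = there (memℕ≡true⇒∈ mem)

∉⇒memℕ≡false : ∀ {x xs} → x ∉ xs → memℕ x xs ≡ false
∉⇒memℕ≡false {x} {xs} x∉xs with memℕ x xs in mem
... | true  = ⊥-elim (x∉xs (memℕ≡true⇒∈ mem))
... | false = refl

memℕ-filter : ∀ (p : ℕ → Bool) {j xs} → j ∈ xs → memℕ j (filter (λ i → p i Bool.≟ true) xs) ≡ p j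
memℕ-filter p {j} {xs} j∈xs with p j in pj
... | true  = ∈⇒memℕ≡true (∈-filter⁺ (λ i → p i Bool.≟ true) j∈xs pj)
... | false = ∉⇒memℕ≡false λ j∈ → true≢false (trans (sym (proj₂ (∈-filter⁻ (λ i → p i Bool.≟ true) {xs = xs} j∈))) pj)

module Fold {c ℓ′ : Level} (M : CommutativeMonoid c ℓ′) where
  open CommutativeMonoid M renaming (refl to ≈-refl; sym to ≈-sym; trans to ≈-trans)
  open import Relation.Binary.Reasoning.Setoid setoid

  fold : {A : Set} → (A → Carrier) → List A → Carrier
  fold f = foldr (λ a s → f a ∙ s) ε

  fold-↭ : ∀ {A : Set} (f : A → Carrier) {xs ys} → xs ↭ ys → fold f xs ≈ fold f ys
  fold-↭ f {xs} {ys} xs↭ys = begin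
    fold f xs              ≡⟨ foldr-map _∙_ f ε xs ⟨
    foldr _∙_ ε (map f xs) ≈⟨ ↭ₛ.foldr-commMonoid setoid isCommutativeMonoid
                                (↭⇒↭ₛ′ isEquivalence (↭.map⁺ f xs↭ys)) ⟩
    foldr _∙_ ε (map f ys) ≡⟨ foldr-map _∙_ f ε ys ⟩
    fold f ys              ∎

  fold-++ : ∀ {A : Set} (f : A → Carrier) xs ys → fold f (xs ++ ys) ≈ fold f xs ∙ fold f ys
  fold-++ f []       ys = ≈-sym (identityˡ _)
  fold-++ f (x ∷ xs) ys = ≈-trans (∙-congˡ (fold-++ f xs ys)) (≈-sym (assoc _ _ _))

  fold-concatMap : ∀ {A B : Set} (F : A → List B) (f : B → Carrier) xs →
                   fold f (concatMap F xs) ≈ fold (fold f ∘ F) xs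
  fold-concatMap F f []       = ≈-refl
  fold-concatMap F f (x ∷ xs) = ≈-trans (fold-++ f (F x) (concatMap F xs)) (∙-congˡ (fold-concatMap F f xs))

  fold-cong : ∀ {A : Set} {f g : A → Carrier} xs → (∀ {x} → x ∈ xs → f x ≈ g x) → fold f xs ≈ fold g xs
  fold-cong []       f≈g = ≈-refl
  fold-cong (x ∷ xs) f≈g = ∙-cong (f≈g (here refl)) (fold-cong xs (f≈g ∘ there))

∈-concatMap-find : ∀ {A B : Set} (F : A → List B) xs {y} → y ∈ concatMap F xs → ∃[ x ] (x ∈ xs × y ∈ F x)
∈-concatMap-find F xs = find ∘ ∈-concatMap⁻ F {xs = xs}

∈-concatMap-lose : ∀ {A B : Set} (F : A → List B) {xs x y} → x ∈ xs → y ∈ F x → y ∈ concatMap F xs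
∈-concatMap-lose F x∈xs y∈Fx = ∈-concatMap⁺ F (lose x∈xs y∈Fx)

unique-map : ∀ {A B : Set} (f : A → B) {xs} → Unique xs →
             (∀ {x y} → x ∈ xs → y ∈ xs → f x ≡ f y → x ≡ y) → Unique (map f xs)
unique-map f {[]}     []            _   = []
unique-map f {x ∷ xs} (x∉xs ∷ !xs) inj =
  All.tabulate (λ fy∈ fx≡fy → let y , y∈xs , fy≡ = ∈-map⁻ f fy∈ in
                 All.lookup x∉xs y∈xs (inj (here refl) (there y∈xs) (trans fx≡fy fy≡)))
  ∷ unique-map f !xs (λ p q → inj (there p) (there q))

unique-concatMap-map : ∀ {A B C : Set} (g : A → B → C) (F : A → List B) {xs} → Unique xs →
  (∀ {x} → x ∈ xs → Unique (F x)) →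
  (∀ {x x′ y y′} → x ∈ xs → x′ ∈ xs → y ∈ F x → y′ ∈ F x′ → g x y ≡ g x′ y′ → x ≡ x′ × y ≡ y′) →
  Unique (concatMap (λ x → map (g x) (F x)) xs)
unique-concatMap-map g F {[]}     []            _   _   = []
unique-concatMap-map g F {x ∷ xs} (x∉xs ∷ !xs) !F inj =
  Unique.++⁺ (unique-map (g x) (!F (here refl)) λ p q e → proj₂ (inj (here refl) (here refl) p q e))
             (unique-concatMap-map g F !xs (!F ∘ there) λ p q → inj (there p) (there q))
             disjoint
  where
  disjoint : ∀ {v} → ¬ (v ∈ map (g x) (F x) × v ∈ concatMap (λ x → map (g x) (F x)) xs)
  disjoint (v∈gF , v∈rest) with ∈-map⁻ (g x) v∈gF | ∈-concatMap-find (λ x → map (g x) (F x)) xs v∈rest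
  ... | y , y∈F , refl | x′ , x′∈xs , v∈gF′ with ∈-map⁻ (g x′) v∈gF′
  ... | y′ , y′∈F , e = All.lookup x∉xs x′∈xs (proj₁ (inj (here refl) (there x′∈xs) y∈F y′∈F e))

module _ {A : Set} (as : List A) where

  ∈-words⁻ : ∀ m {u} → u ∈ words as m → length u ≡ m × All (_∈ as) u
  ∈-words⁻ zero    (here refl) = refl , []
  ∈-words⁻ (suc m) u∈ with ∈-concatMap-find (λ a → map (a ∷_) (words as m)) as u∈
  ... | a , a∈as , au∈ with ∈-map⁻ (a ∷_) au∈
  ... | u , u∈ , refl = let len , u⊆ = ∈-words⁻ m u∈ in cong suc len , a∈as ∷ u⊆

  ∈-words⁺ : ∀ m {u} → length u ≡ m → All (_∈ as) u → u ∈ words as m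
  ∈-words⁺ zero    {[]}    _   []           = here refl
  ∈-words⁺ (suc m) {a ∷ u} len (a∈as ∷ u⊆) =
    ∈-concatMap-lose (λ a → map (a ∷_) (words as m)) a∈as (∈-map⁺ (a ∷_) (∈-words⁺ m (suc-injective len) u⊆))

  words-unique : Unique as → ∀ m → Unique (words as m)
  words-unique !as zero    = [] ∷ []
  words-unique !as (suc m) =
    unique-concatMap-map _∷_ (λ _ → words as m) !as (λ _ → words-unique !as m) (λ _ _ _ _ → ∷-injective)

  ∈-fillings⁻ : ∀ α {T} → T ∈ fillings as α → map length T ≡ α × All (All (_∈ as)) T
  ∈-fillings⁻ []      (here refl) = refl , []
  ∈-fillings⁻ (a ∷ α) T∈ with ∈-concatMap-find (λ r → map (r ∷_) (fillings as α)) (words as a) T∈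
  ... | r , r∈ , rT∈ with ∈-map⁻ (r ∷_) rT∈
  ... | T , T∈ , refl = let shape , T⊆ = ∈-fillings⁻ α T∈ ; len , r⊆ = ∈-words⁻ a r∈ in
                        cong₂ _∷_ len shape , r⊆ ∷ T⊆

  ∈-fillings⁺ : ∀ α {T} → map length T ≡ α → All (All (_∈ as)) T → T ∈ fillings as α
  ∈-fillings⁺ []      {[]}    _     []         = here refl
  ∈-fillings⁺ (a ∷ α) {r ∷ T} shape (r⊆ ∷ T⊆) =
    ∈-concatMap-lose (λ r → map (r ∷_) (fillings as α)) (∈-words⁺ a (proj₁ (∷-injective shape)) r⊆)
      (∈-map⁺ (r ∷_) (∈-fillings⁺ α (proj₂ (∷-injective shape)) T⊆))

  fillings-unique : Unique as → ∀ α → Unique (fillings as α)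
  fillings-unique !as []      = [] ∷ []
  fillings-unique !as (a ∷ α) =
    unique-concatMap-map _∷_ (λ _ → fillings as α) (words-unique !as a)
      (λ _ → fillings-unique !as α) (λ _ _ _ _ → ∷-injective)

module _ {ℓ k : ℕ} where

  ∈-allLetters : (a : Letter ℓ k) → a ∈ allLetters ℓ k
  ∈-allLetters (inj₁ i) = ∈-++⁺ˡ (∈-map⁺ inj₁ (∈-allFin i))
  ∈-allLetters (inj₂ j) = ∈-++⁺ʳ (map inj₁ (allFin ℓ)) (∈-map⁺ inj₂ (∈-allFin j))

  allLetters-unique : Unique (allLetters ℓ k)
  allLetters-unique =
    Unique.++⁺ (Unique.map⁺ ⊎.inj₁-injective (Unique.allFin⁺ ℓ))
               (Unique.map⁺ ⊎.inj₂-injective (Unique.allFin⁺ k)) disjoint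
    where
    disjoint : ∀ {v} → ¬ (v ∈ map inj₁ (allFin ℓ) × v ∈ map inj₂ (allFin k))
    disjoint (v∈₁ , v∈₂) with ∈-map⁻ inj₁ v∈₁ | ∈-map⁻ inj₂ v∈₂
    ... | _ , _ , refl | _ , _ , ()

oneTo≡applyUpTo : ∀ n → oneTo n ≡ applyUpTo suc n
oneTo≡applyUpTo n = map-applyUpTo id suc n

length-oneTo : ∀ n → length (oneTo n) ≡ n
length-oneTo n = trans (cong length (oneTo≡applyUpTo n)) (length-applyUpTo suc n)

oneTo-↗ : ∀ n → AllPairs _<_ (oneTo n)
oneTo-↗ n = subst (AllPairs _<_) (sym (oneTo≡applyUpTo n)) (AllPairs.applyUpTo⁺₁ suc n λ i<j _ → s<s i<j)

∈-oneTo⁺ : ∀ {n j} → 1 ≤ j → j ≤ n → j ∈ oneTo n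
∈-oneTo⁺ {n} {suc j} _ j<n = subst (suc j ∈_) (sym (oneTo≡applyUpTo n)) (∈-applyUpTo⁺ suc j<n)

∈-oneTo⁻ : ∀ {n j} → j ∈ oneTo n → 1 ≤ j × j ≤ n
∈-oneTo⁻ {n} j∈ with ∈-applyUpTo⁻ suc (subst (_ ∈_) (oneTo≡applyUpTo n) j∈)
... | i , i<n , refl = s≤s z≤n , i<n

↗⇒unique : ∀ {xs} → AllPairs _<_ xs → Unique xs
↗⇒unique = AllPairs.map λ x<y x≡y → <-irrefl x≡y x<y

count≡length∘filter : ∀ v xs → count v xs ≡ length (filter (v ℕ.≟_) xs)
count≡length∘filter v []       = refl
count≡length∘filter v (w ∷ xs) with v ≡ᵇ w in v≡ᵇw | v ℕ.≟ w
... | true  | yes _   = cong suc (count≡length∘filter v xs)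
... | true  | no v≢w  = ⊥-elim (v≢w (≡ᵇ≡true⇒≡ v≡ᵇw))
... | false | yes v≡w = ⊥-elim (true≢false (trans (sym (subst (λ w → (v ≡ᵇ w) ≡ true) v≡w (≡ᵇ-refl v))) v≡ᵇw))
... | false | no _    = count≡length∘filter v xs

count-↭ : ∀ v {xs ys} → xs ↭ ys → count v xs ≡ count v ys
count-↭ v {xs} {ys} xs↭ys = begin
  count v xs                        ≡⟨ count≡length∘filter v xs ⟩
  length (filter (v ℕ.≟_) xs)       ≡⟨ ↭.↭-length (↭.filter-↭ (v ℕ.≟_) xs↭ys) ⟩
  length (filter (v ℕ.≟_) ys)       ≡⟨ count≡length∘filter v ys ⟨
  count v ys                        ∎
  where open ≡.≡-Reasoning

count-++ : ∀ v xs ys → count v (xs ++ ys) ≡ count v xs + count v ys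
count-++ v []       ys = refl
count-++ v (w ∷ xs) ys with v ≡ᵇ w
... | true  = cong suc (count-++ v xs ys)
... | false = count-++ v xs ys

∈⇒count>0 : ∀ {v xs} → v ∈ xs → 0 < count v xs
∈⇒count>0 {v} {w ∷ xs} (here refl) rewrite ≡ᵇ-refl v = z<s
∈⇒count>0 {v} {w ∷ xs} (there v∈xs) with v ≡ᵇ w
... | true  = z<s
... | false = ∈⇒count>0 v∈xs

count>0⇒∈ : ∀ {v xs} → 0 < count v xs → v ∈ xs
count>0⇒∈ {v} {w ∷ xs} pos with v ≡ᵇ w in v≡ᵇw
... | true  = here (≡ᵇ≡true⇒≡ v≡ᵇw)
... | false = there (count>0⇒∈ pos)

count-unique : ∀ {v xs} → Unique xs → v ∈ xs → count v xs ≡ 1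
count-unique {v} {w ∷ xs} (w∉xs ∷ _) (here refl) rewrite ≡ᵇ-refl v =
  cong suc (count-absent (All.map (λ v≢u u≡v → v≢u (sym u≡v)) w∉xs))
  where
  count-absent : ∀ {ys} → All (_≢ v) ys → count v ys ≡ 0
  count-absent []             = refl
  count-absent {u ∷ ys} (u≢v ∷ rest) rewrite ≢⇒≡ᵇ≡false (λ v≡u → u≢v (sym v≡u)) = count-absent rest
count-unique {v} {w ∷ xs} (w∉xs ∷ !xs) (there v∈xs)
  rewrite ≢⇒≡ᵇ≡false (λ v≡w → All.lookup w∉xs v∈xs (sym v≡w)) = count-unique !xs v∈xs

-- Tableaux as lists of rows

applyUpTo-cong : ∀ {A : Set} {f g : ℕ → A} m → (∀ {r} → r < m → f r ≡ g r) → applyUpTo f m ≡ applyUpTo g m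
applyUpTo-cong zero    f≡g = refl
applyUpTo-cong (suc m) f≡g = cong₂ _∷_ (f≡g z<s) (applyUpTo-cong m (f≡g ∘ s<s))

module _ {A : Set} where

  nthRow : ℕ → List (List A) → List A
  nthRow r       []      = []
  nthRow zero    (R ∷ T) = R
  nthRow (suc r) (R ∷ T) = nthRow r T

  NonEmpty : List A → Set
  NonEmpty R = 0 < length R

  -- nthRow is [] past the last row, so no bound on r is needed.
  HeadsLinked : (A → A → Set) → List (List A) → Set
  HeadsLinked _~_ T = ∀ r {x y} → head (nthRow r T) ≡ just x → head (nthRow (suc r) T) ≡ just y → x ~ y

  ≡applyUpTo-nthRow : ∀ T → T ≡ applyUpTo (λ r → nthRow r T) (length T)
  ≡applyUpTo-nthRow []      = refl
  ≡applyUpTo-nthRow (R ∷ T) = cong (R ∷_) (≡applyUpTo-nthRow T)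

  nthRow-applyUpTo : ∀ (f : ℕ → List A) {m r} → r < m → nthRow r (applyUpTo f m) ≡ f r
  nthRow-applyUpTo f {suc m} {zero}  _         = refl
  nthRow-applyUpTo f {suc m} {suc r} (s<s r<m) = nthRow-applyUpTo (f ∘ suc) r<m

  head-nthRow⇒< : ∀ T {r x} → head (nthRow r T) ≡ just x → r < length T
  head-nthRow⇒< (R ∷ T) {zero}  _  = z<s
  head-nthRow⇒< (R ∷ T) {suc r} hd = s<s (head-nthRow⇒< T hd)

  head-∈ : ∀ {R : List A} {x} → head R ≡ just x → x ∈ R
  head-∈ {x ∷ R} refl = here refl

  head-AllPairs : ∀ {_~_ : A → A → Set} {R x y} → AllPairs _~_ R → head R ≡ just x → y ∈ R → y ≡ x ⊎ x ~ y
  head-AllPairs {R = x ∷ R} (x~ ∷ _) refl (here refl) = inj₁ refl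
  head-AllPairs {R = x ∷ R} (x~ ∷ _) refl (there y∈) = inj₂ (All.lookup x~ y∈)

  All-nthRow : ∀ {P : List A → Set} {T} → All P T → P [] → ∀ r → P (nthRow r T)
  All-nthRow []          P[] r       = P[]
  All-nthRow (PR ∷ _)    P[] zero    = PR
  All-nthRow (_ ∷ PT)    P[] (suc r) = All-nthRow PT P[] r

  nonEmpty-nthRow : ∀ {T} → All NonEmpty T → ∀ {r} → r < length T → ∃[ x ] (head (nthRow r T) ≡ just x)
  nonEmpty-nthRow {(x ∷ R) ∷ T} (_ ∷ _)  {zero}  _         = x , refl
  nonEmpty-nthRow {R ∷ T}       (_ ∷ ne) {suc r} (s<s r<l) = nonEmpty-nthRow ne r<l

  ∈-nthRow⇒∈-concat : ∀ T {r v} → v ∈ nthRow r T → v ∈ concat T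
  ∈-nthRow⇒∈-concat (R ∷ T) {zero}  v∈ = ∈-++⁺ˡ v∈
  ∈-nthRow⇒∈-concat (R ∷ T) {suc r} v∈ = ∈-++⁺ʳ R (∈-nthRow⇒∈-concat T v∈)

  ∈-concat⇒∈-nthRow : ∀ T {v} → v ∈ concat T → ∃[ r ] (r < length T × v ∈ nthRow r T)
  ∈-concat⇒∈-nthRow (R ∷ T) v∈ with ∈-++⁻ R v∈
  ... | inj₁ v∈R = 0 , z<s , v∈R
  ... | inj₂ v∈T = let r , r<l , v∈r = ∈-concat⇒∈-nthRow T v∈T in suc r , s<s r<l , v∈r

  firstColumn-Linked : ∀ {_~_} T → All NonEmpty T → HeadsLinked _~_ T → Linked _~_ (firstColumn T)
  firstColumn-Linked []                            _             _      = []
  firstColumn-Linked ((x ∷ R) ∷ [])                _             _      = [-]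
  firstColumn-Linked ((x ∷ R) ∷ (y ∷ R′) ∷ T)      (_ ∷ ne)      linked =
    linked 0 refl refl ∷ firstColumn-Linked ((y ∷ R′) ∷ T) ne (linked ∘ suc)
  firstColumn-Linked ([] ∷ T)                      (() ∷ _)      _
  firstColumn-Linked ((x ∷ R) ∷ [] ∷ T)            (_ ∷ () ∷ _)  _

  Linked-firstColumn : ∀ {_~_} T → All NonEmpty T → Linked _~_ (firstColumn T) → HeadsLinked _~_ T
  Linked-firstColumn ((x ∷ R) ∷ (y ∷ R′) ∷ T) _        (x~y ∷ _) zero    refl refl = x~y
  Linked-firstColumn ((x ∷ R) ∷ (y ∷ R′) ∷ T) (_ ∷ ne) (_ ∷ lk)  (suc r) hx   hy   =
    Linked-firstColumn ((y ∷ R′) ∷ T) ne lk r hx hy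
  Linked-firstColumn ((x ∷ R) ∷ [] ∷ T)       (_ ∷ () ∷ _)
  Linked-firstColumn ((x ∷ R) ∷ [])           _        _         zero    _    ()
  Linked-firstColumn ((x ∷ R) ∷ [])           _        _         (suc r) ()   _

nonEmpty-rows : ∀ {A : Set} {T : List (List A)} {α} → map length T ≡ α → Positive α → All NonEmpty T
nonEmpty-rows {T = []}    refl []          = []
nonEmpty-rows {T = R ∷ T} refl (pos ∷ pos′) = pos ∷ nonEmpty-rows refl pos′

rowOf-≡ : ∀ v (T : List (List ℕ)) r → v ∈ nthRow r T → (∀ {r′} → r′ < r → v ∉ nthRow r′ T) → rowOf v T ≡ r
rowOf-≡ v (R ∷ T) zero    v∈ _     rewrite ∈⇒memℕ≡true v∈ = refl
rowOf-≡ v (R ∷ T) (suc r) v∈ above rewrite ∉⇒memℕ≡false (above z<s) =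
  cong suc (rowOf-≡ v T r v∈ (above ∘ s<s))

count-++-both : ∀ {v} xs ys → v ∈ xs → v ∈ ys → 1 < count v (xs ++ ys)
count-++-both {v} xs ys v∈xs v∈ys =
  subst (1 <_) (sym (count-++ v xs ys)) (+-mono-≤ (∈⇒count>0 v∈xs) (∈⇒count>0 v∈ys))

count≡1⇒unique-row : ∀ {v} (T : List (List ℕ)) → count v (concat T) ≡ 1 →
                     ∀ {r r′} → v ∈ nthRow r T → v ∈ nthRow r′ T → r ≡ r′
count≡1⇒unique-row (R ∷ T) once {zero}  {zero}   _   _   = refl
count≡1⇒unique-row (R ∷ T) once {zero}  {suc r′} v∈R v∈T =
  ⊥-elim (<-irrefl (sym once) (count-++-both R (concat T) v∈R (∈-nthRow⇒∈-concat T v∈T)))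
count≡1⇒unique-row (R ∷ T) once {suc r} {zero}   v∈T v∈R =
  ⊥-elim (<-irrefl (sym once) (count-++-both R (concat T) v∈R (∈-nthRow⇒∈-concat T v∈T)))
count≡1⇒unique-row {v} (R ∷ T) once {suc r} {suc r′} v∈ v∈′ = cong suc (count≡1⇒unique-row T once′ v∈ v∈′)
  where
  once′ : count v (concat T) ≡ 1
  once′ = ≤-antisym (subst (count v (concat T) ≤_) (trans (sym (count-++ v R (concat T))) once) (m≤n+m _ _))
                    (∈⇒count>0 (∈-nthRow⇒∈-concat T v∈))

module _ {A : Set} {_≼_ : A → A → Set} (isTotalOrder : IsTotalOrder _≡_ _≼_) where

  Linked-↭⇒≡ : ∀ {xs ys} → Linked _≼_ xs → Linked _≼_ ys → xs ↭ ys → xs ≡ ys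
  Linked-↭⇒≡ xs↗ ys↗ xs↭ys =
    Pointwise-≡⇒≡ (Sorted.↗↭↗⇒≋ record { isTotalOrder = isTotalOrder } xs↗ ys↗ (↭⇒↭ₛ′ ≡.isEquivalence xs↭ys))

sameMembers⇒↭ : ∀ {A : Set} {xs ys : List A} → Unique xs → Unique ys →
                (∀ {z} → z ∈ xs → z ∈ ys) → (∀ {z} → z ∈ ys → z ∈ xs) → xs ↭ ys
sameMembers⇒↭ !xs !ys xs⊆ys ys⊆xs = ∼bag⇒↭ (unique∧set⇒bag !xs !ys (mk⇔ xs⊆ys ys⊆xs))

↗-sameMembers⇒≡ : ∀ {xs ys} → AllPairs _<_ xs → AllPairs _<_ ys →
                  (∀ {z} → z ∈ xs → z ∈ ys) → (∀ {z} → z ∈ ys → z ∈ xs) → xs ≡ ys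
↗-sameMembers⇒≡ xs↗ ys↗ xs⊆ys ys⊆xs =
  Linked-↭⇒≡ ≤-isTotalOrder (weaken xs↗) (weaken ys↗) (sameMembers⇒↭ (↗⇒unique xs↗) (↗⇒unique ys↗) xs⊆ys ys⊆xs)
  where
  weaken : ∀ {zs} → AllPairs _<_ zs → Linked _≤_ zs
  weaken = Linked.map <⇒≤ ∘ Linked.AllPairs⇒Linked

module _ {X Y : Set} where

  map-proj₁-zip : ∀ (xs : List X) (ys : List Y) → length xs ≡ length ys → map proj₁ (zip xs ys) ≡ xs
  map-proj₁-zip []       []       _   = refl
  map-proj₁-zip (x ∷ xs) (y ∷ ys) len = cong (x ∷_) (map-proj₁-zip xs ys (suc-injective len))

  map-proj₂-zip : ∀ (xs : List X) (ys : List Y) → length xs ≡ length ys → map proj₂ (zip xs ys) ≡ ys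
  map-proj₂-zip []       []       _   = refl
  map-proj₂-zip (x ∷ xs) (y ∷ ys) len = cong (y ∷_) (map-proj₂-zip xs ys (suc-injective len))

  zip-map-proj : ∀ (b : List (X × Y)) → zip (map proj₁ b) (map proj₂ b) ≡ b
  zip-map-proj []      = refl
  zip-map-proj (p ∷ b) = cong (p ∷_) (zip-map-proj b)

  ∈-zip⇒∈ˡ : ∀ {xs : List X} {ys : List Y} {p} → p ∈ zip xs ys → proj₁ p ∈ xs
  ∈-zip⇒∈ˡ {x ∷ xs} {y ∷ ys} (here refl) = here refl
  ∈-zip⇒∈ˡ {x ∷ xs} {y ∷ ys} (there p∈)  = there (∈-zip⇒∈ˡ p∈)

  ∈-zip⇒∈ʳ : ∀ {xs : List X} {ys : List Y} {p} → p ∈ zip xs ys → proj₂ p ∈ ys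
  ∈-zip⇒∈ʳ {x ∷ xs} {y ∷ ys} (here refl) = here refl
  ∈-zip⇒∈ʳ {x ∷ xs} {y ∷ ys} (there p∈)  = there (∈-zip⇒∈ʳ p∈)

  ∈-zip-map⁺ : ∀ (f : X → Y) {xs v} → v ∈ xs → (v , f v) ∈ zip xs (map f xs)
  ∈-zip-map⁺ f {x ∷ xs} (here refl) = here refl
  ∈-zip-map⁺ f {x ∷ xs} (there v∈)  = there (∈-zip-map⁺ f v∈)

  ∈-zip-map⁻ : ∀ (f : X → Y) {xs v t} → (v , t) ∈ zip xs (map f xs) → v ∈ xs × t ≡ f v
  ∈-zip-map⁻ f {x ∷ xs} (here refl) = here refl , refl
  ∈-zip-map⁻ f {x ∷ xs} (there p∈)  = let v∈ , t≡ = ∈-zip-map⁻ f p∈ in there v∈ , t≡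

  map-proj₁-graph : ∀ (f : X → Y) b → (∀ {p} → p ∈ b → f (proj₁ p) ≡ proj₂ p) → map f (map proj₁ b) ≡ map proj₂ b
  map-proj₁-graph f []      _     = refl
  map-proj₁-graph f (p ∷ b) graph = cong₂ _∷_ (graph (here refl)) (map-proj₁-graph f b (graph ∘ there))

  zip-AllPairs : ∀ {R : X → X → Set} {xs : List X} {ys : List Y} → AllPairs R xs → AllPairs (R on proj₁) (zip xs ys)
  zip-AllPairs {xs = []}     {ys}     _            = []
  zip-AllPairs {xs = x ∷ xs} {[]}     _            = []
  zip-AllPairs {xs = x ∷ xs} {y ∷ ys} (x~ ∷ xs↗) = All.tabulate (All.lookup x~ ∘ ∈-zip⇒∈ˡ) ∷ zip-AllPairs xs↗

-- Biwords and the tableaux they fill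

concat-applyUpTo-insert : ∀ {A : Set} (F G : ℕ → List A) x {m j} → j < m → F j ≡ x ∷ G j →
                          (∀ {r} → r ≢ j → F r ≡ G r) → concat (applyUpTo F m) ↭ x ∷ concat (applyUpTo G m)
concat-applyUpTo-insert F G x {suc m} {zero} _ Fj≡ F≡G rewrite Fj≡ =
  prep x (↭-reflexive (cong (λ T → G 0 ++ concat T) (applyUpTo-cong m λ _ → F≡G λ ())))
concat-applyUpTo-insert F G x {suc m} {suc j} (s<s j<m) Fj≡ F≡G rewrite F≡G {0} (λ ()) =
  ↭-trans (↭.++⁺ˡ (G 0) (concat-applyUpTo-insert (F ∘ suc) (G ∘ suc) x j<m Fj≡ λ r≢j → F≡G (r≢j ∘ suc-injective)))
          (↭.shift x (G 0) _)

data FirstBefore (r s : ℕ) : List ℕ → Set where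
  here  : ∀ {ρ} → FirstBefore r s (r ∷ ρ)
  there : ∀ {t ρ} → t ≢ s → FirstBefore r s ρ → FirstBefore r s (t ∷ ρ)

module _ {X : Set} where

  inRow? : ∀ r (p : X × ℕ) → Dec (proj₂ p ≡ r)
  inRow? r p = proj₂ p ℕ.≟ r

  rowEntries : ℕ → List (X × ℕ) → List X
  rowEntries r b = map proj₁ (filter (inRow? r) b)

  toTableau : ℕ → List (X × ℕ) → List (List X)
  toTableau m b = applyUpTo (λ r → rowEntries r b) m

  cellsFrom : ℕ → List (List X) → List (X × ℕ)
  cellsFrom s []      = []
  cellsFrom s (R ∷ T) = map (_, s) R ++ cellsFrom (suc s) T

  cells : List (List X) → List (X × ℕ)
  cells = cellsFrom 0

  filter-inRow : ∀ r b → filter (inRow? r) b ≡ map (_, r) (rowEntries r b)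
  filter-inRow r []            = refl
  filter-inRow r ((x , s) ∷ b) with s ℕ.≟ r
  ... | yes refl rewrite filter-accept (inRow? s) {x = x , s} {xs = b} refl = cong ((x , s) ∷_) (filter-inRow r b)
  ... | no s≢r   rewrite filter-reject (inRow? r) {x = x , s} {xs = b} s≢r = filter-inRow r b

  ∈-rowEntries⁻ : ∀ {r b x} → x ∈ rowEntries r b → (x , r) ∈ b
  ∈-rowEntries⁻ {r} {b} x∈ =
    proj₁ (∈-filter⁻ (inRow? r) {xs = b} (subst ((_ , r) ∈_) (sym (filter-inRow r b)) (∈-map⁺ (_, r) x∈)))

  ∈-rowEntries⁺ : ∀ {r b x} → (x , r) ∈ b → x ∈ rowEntries r b
  ∈-rowEntries⁺ {r} x∈ = ∈-map⁺ proj₁ (∈-filter⁺ (inRow? r) x∈ refl)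

  rowEntries-AllPairs : ∀ {R : X × ℕ → X × ℕ → Set} r {b} → AllPairs R b →
                        AllPairs (λ x y → R (x , r) (y , r)) (rowEntries r b)
  rowEntries-AllPairs r {b} b↗ = AllPairs.map⁻ (subst (AllPairs _) (filter-inRow r b) (AllPairs.filter⁺ (inRow? r) b↗))

  rowEntries-↭ : ∀ r {b b′} → b ↭ b′ → rowEntries r b ↭ rowEntries r b′
  rowEntries-↭ r = ↭.map⁺ proj₁ ∘ ↭.filter-↭ (inRow? r)

  rowEntries-accept : ∀ {x} r b → rowEntries r ((x , r) ∷ b) ≡ x ∷ rowEntries r b
  rowEntries-accept {x} r b rewrite filter-accept (inRow? r) {x = x , r} {xs = b} refl = refl

  rowEntries-reject : ∀ {x t r} b → t ≢ r → rowEntries r ((x , t) ∷ b) ≡ rowEntries r b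
  rowEntries-reject {x} {t} {r} b t≢r rewrite filter-reject (inRow? r) {x = x , t} {xs = b} t≢r = refl

  length-rowEntries : ∀ r b → length (rowEntries r b) ≡ count r (map proj₂ b)
  length-rowEntries r []            = refl
  length-rowEntries r ((x , s) ∷ b) with s ℕ.≟ r | r ≡ᵇ s in r≡ᵇs
  ... | yes refl | true  rewrite rowEntries-accept {x = x} s b = cong suc (length-rowEntries r b)
  ... | yes refl | false = ⊥-elim (true≢false (trans (sym (≡ᵇ-refl s)) r≡ᵇs))
  ... | no s≢r   | true  = ⊥-elim (s≢r (sym (≡ᵇ≡true⇒≡ r≡ᵇs)))
  ... | no s≢r   | false rewrite rowEntries-reject {x = x} b s≢r = length-rowEntries r b

  nthRow-toTableau : ∀ {m r} b → r < m → nthRow r (toTableau m b) ≡ rowEntries r b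
  nthRow-toTableau b = nthRow-applyUpTo (λ r → rowEntries r b)

  length-toTableau : ∀ m b → length (toTableau m b) ≡ m
  length-toTableau m b = length-applyUpTo (λ r → rowEntries r b) m

  shape-toTableau : ∀ m b → map length (toTableau m b) ≡ applyUpTo (λ r → count r (map proj₂ b)) m
  shape-toTableau m b = trans (map-applyUpTo (λ r → rowEntries r b) length m)
                              (applyUpTo-cong m λ {r} _ → length-rowEntries r b)

  rows-partition-↭ : ∀ m b → All (λ p → proj₂ p < m) b → concat (applyUpTo (λ r → filter (inRow? r) b) m) ↭ b
  rows-partition-↭ m []            [] = ↭-reflexive (concat-empty m)
    where
    concat-empty : ∀ m → concat (applyUpTo (λ r → filter (inRow? r) []) m) ≡ []
    concat-empty zero    = refl
    concat-empty (suc m) = concat-empty m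
  rows-partition-↭ m ((x , s) ∷ b) (s<m ∷ b<m) =
    ↭-trans (concat-applyUpTo-insert (λ r → filter (inRow? r) ((x , s) ∷ b)) (λ r → filter (inRow? r) b) (x , s)
               s<m (filter-accept (inRow? s) refl) λ r≢s → filter-reject (inRow? _) (r≢s ∘ sym))
            (prep (x , s) (rows-partition-↭ m b b<m))

  rowEntries-++ : ∀ r xs ys → rowEntries r (xs ++ ys) ≡ rowEntries r xs ++ rowEntries r ys
  rowEntries-++ r xs ys =
    trans (cong (map proj₁) (filter-++ (inRow? r) xs ys)) (map-++ proj₁ (filter (inRow? r) xs) (filter (inRow? r) ys))

  rowEntries-row : ∀ r R → rowEntries r (map (_, r) R) ≡ R
  rowEntries-row r R = begin
    map proj₁ (filter (inRow? r) (map (_, r) R))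
      ≡⟨ cong (map proj₁) (filter-all (inRow? r) (All.map⁺ (All.tabulate λ _ → refl))) ⟩
    map proj₁ (map (_, r) R)                     ≡⟨ map-∘ R ⟨
    map id R                                     ≡⟨ map-id R ⟩
    R                                            ∎
    where open ≡.≡-Reasoning

  rowEntries-absent : ∀ r {b} → All (λ p → proj₂ p ≢ r) b → rowEntries r b ≡ []
  rowEntries-absent r b≢r = cong (map proj₁) (filter-none (inRow? r) b≢r)

  cellsFrom-rows : ∀ s T → All (λ p → s ≤ proj₂ p × proj₂ p < s + length T) (cellsFrom s T)
  cellsFrom-rows s []      = []
  cellsFrom-rows s (R ∷ T) =
    All.++⁺ (All.map⁺ (All.tabulate λ _ → ≤-refl , m<m+n s z<s))
            (All.map (λ {p} (s<t , t<) → <⇒≤ s<t , subst (proj₂ p <_) (sym (+-suc s (length T))) t<)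
                     (cellsFrom-rows (suc s) T))

  rowEntries-cellsFrom : ∀ t s T → rowEntries (t + s) (cellsFrom s T) ≡ nthRow t T
  rowEntries-cellsFrom t s [] = refl
  rowEntries-cellsFrom zero s (R ∷ T) = begin
    rowEntries s (map (_, s) R ++ cellsFrom (suc s) T)            ≡⟨ rowEntries-++ s (map (_, s) R) _ ⟩
    rowEntries s (map (_, s) R) ++ rowEntries s (cellsFrom (suc s) T)
      ≡⟨ cong₂ _++_ (rowEntries-row s R)
                    (rowEntries-absent s (All.map (λ (s<t , _) → >⇒≢ s<t) (cellsFrom-rows (suc s) T))) ⟩
    R ++ []                                                       ≡⟨ ++-identityʳ R ⟩
    R                                                             ∎
    where open ≡.≡-Reasoning
  rowEntries-cellsFrom (suc t) s (R ∷ T) = begin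
    rowEntries (suc t + s) (map (_, s) R ++ cellsFrom (suc s) T)  ≡⟨ rowEntries-++ (suc t + s) (map (_, s) R) _ ⟩
    rowEntries (suc t + s) (map (_, s) R) ++ rowEntries (suc t + s) (cellsFrom (suc s) T)
      ≡⟨ cong₂ _++_ (rowEntries-absent (suc t + s)
                       (All.map⁺ {f = _, s} (All.tabulate {xs = R} λ _ → <⇒≢ (s<s (m≤n+m s t)))))
                    (cong (λ r → rowEntries r (cellsFrom (suc s) T)) (sym (+-suc t s))) ⟩
    rowEntries (t + suc s) (cellsFrom (suc s) T)                  ≡⟨ rowEntries-cellsFrom t (suc s) T ⟩
    nthRow t T                                                    ∎
    where open ≡.≡-Reasoning

  rowEntries-cells : ∀ r T → rowEntries r (cells T) ≡ nthRow r T
  rowEntries-cells r T =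
    subst (λ r′ → rowEntries r′ (cells T) ≡ nthRow r T) (+-identityʳ r) (rowEntries-cellsFrom r 0 T)

  cells-rows : ∀ T → All (λ p → proj₂ p < length T) (cells T)
  cells-rows T = All.map proj₂ (cellsFrom-rows 0 T)

  length-cellsFrom : ∀ s T → length (cellsFrom s T) ≡ sum (map length T)
  length-cellsFrom s []      = refl
  length-cellsFrom s (R ∷ T) =
    trans (length-++ (map (_, s) R)) (cong₂ _+_ (length-map (_, s) R) (length-cellsFrom (suc s) T))

  firstBefore⇒heads : ∀ {R : X × ℕ → X × ℕ → Set} {r s} → r ≢ s → ∀ b → AllPairs R b →
                      FirstBefore r s (map proj₂ b) → ∀ {x y} →
                      head (rowEntries r b) ≡ just x → head (rowEntries s b) ≡ just y → R (x , r) (y , s)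
  firstBefore⇒heads {r = r} {s} r≢s ((x₀ , t) ∷ b) (x₀~ ∷ b↗) fb hx hy with t ℕ.≟ r
  ... | yes refl with refl ← trans (cong head (sym (rowEntries-accept {x = x₀} r b))) hx =
    All.lookup x₀~ (∈-rowEntries⁻ (head-∈ (trans (cong head (sym (rowEntries-reject b r≢s))) hy)))
  ... | no t≢r with fb
  ...   | here          = ⊥-elim (t≢r refl)
  ...   | there t≢s fb′ = firstBefore⇒heads r≢s b b↗ fb′
    (trans (cong head (sym (rowEntries-reject b t≢r))) hx) (trans (cong head (sym (rowEntries-reject b t≢s))) hy)

  minimal⇒firstBefore : ∀ {R : X × ℕ → X × ℕ → Set} → (∀ {p q} → R p q → R q p → p ≡ q) →
                        ∀ {r s} → r ≢ s → ∀ b → AllPairs R b → ∀ {y} → (y , r) ∈ b →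
                        (∀ {z} → (z , s) ∈ b → R (y , r) (z , s)) → FirstBefore r s (map proj₂ b)
  minimal⇒firstBefore antisym {r} {s} r≢s ((x₀ , t) ∷ b) (x₀~ ∷ b↗) y∈ y≤ with t ℕ.≟ r | t ℕ.≟ s
  ... | yes refl | _        = here
  ... | no t≢r   | no t≢s   = there t≢s (minimal⇒firstBefore antisym r≢s b b↗ (y∈b y∈) (y≤ ∘ there))
    where
    y∈b : ∀ {y} → (y , r) ∈ (x₀ , t) ∷ b → (y , r) ∈ b
    y∈b (here refl) = ⊥-elim (t≢r refl)
    y∈b (there y∈)  = y∈
  ... | no t≢r   | yes refl with y∈
  ...   | here refl = ⊥-elim (t≢r refl)
  ...   | there y∈b = ⊥-elim (r≢s (cong proj₂ (antisym (y≤ (here refl)) (All.lookup x₀~ y∈b))))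

  toTableau-HeadsLinked : ∀ {R : X × ℕ → X × ℕ → Set} {_~_ : X → X → Set} m b → AllPairs R b →
                          (∀ {r} → suc r < m → FirstBefore r (suc r) (map proj₂ b)) →
                          (∀ {x y r} → R (x , r) (y , suc r) → x ~ y) → HeadsLinked _~_ (toTableau m b)
  toTableau-HeadsLinked m b b↗ fb R⇒~ r hx hy = R⇒~ (firstBefore⇒heads (<⇒≢ (n<1+n r)) b b↗ (fb 1+r<m)
    (trans (cong head (sym (nthRow-toTableau b (<⇒≤ 1+r<m)))) hx)
    (trans (cong head (sym (nthRow-toTableau b 1+r<m))) hy))
    where
    1+r<m : suc r < m
    1+r<m = subst (suc r <_) (length-toTableau m b) (head-nthRow⇒< (toTableau m b) hy)

  concat-toTableau-↭ : ∀ m b → All (λ p → proj₂ p < m) b → concat (toTableau m b) ↭ map proj₁ b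
  concat-toTableau-↭ m b b<m = begin
    concat (applyUpTo (map proj₁ ∘ rows) m)      ≡⟨ cong concat (map-applyUpTo rows (map proj₁) m) ⟨
    concat (map (map proj₁) (applyUpTo rows m))  ≡⟨ concat-map (applyUpTo rows m) ⟩
    map proj₁ (concat (applyUpTo rows m))        ↭⟨ ↭.map⁺ proj₁ (rows-partition-↭ m b b<m) ⟩
    map proj₁ b                                  ∎
    where
    open PermutationReasoning
    rows : ℕ → List (X × ℕ)
    rows r = filter (inRow? r) b

  toTableau-injective-↭ : ∀ m {b b′} → All (λ p → proj₂ p < m) b → All (λ p → proj₂ p < m) b′ →
                          toTableau m b ≡ toTableau m b′ → b ↭ b′
  toTableau-injective-↭ m {b} {b′} b<m b′<m same = begin
    b                                                      ↭⟨ rows-partition-↭ m b b<m ⟨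
    concat (applyUpTo (λ r → filter (inRow? r) b) m)       ≡⟨ cong concat (applyUpTo-cong m sameRow) ⟩
    concat (applyUpTo (λ r → filter (inRow? r) b′) m)      ↭⟨ rows-partition-↭ m b′ b′<m ⟩
    b′                                                     ∎
    where
    open PermutationReasoning
    sameRow : ∀ {r} → r < m → filter (inRow? r) b ≡ filter (inRow? r) b′
    sameRow {r} r<m = trans (filter-inRow r b) (trans (cong (map (_, r)) sameEntries) (sym (filter-inRow r b′)))
      where
      sameEntries : rowEntries r b ≡ rowEntries r b′
      sameEntries = trans (sym (nthRow-toTableau b r<m)) (trans (cong (nthRow r) same) (nthRow-toTableau b′ r<m))

-- Letters and the hook order on cells

module _ {ℓ k : ℕ} where

  rank : Letter ℓ k → ℕ
  rank (inj₁ i) = toℕ i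
  rank (inj₂ j) = ℓ + toℕ j

  unprimed<primed : ∀ i j → rank (inj₁ {B = Fin k} i) < rank (inj₂ {A = Fin ℓ} j)
  unprimed<primed i j = <-≤-trans (toℕ<n i) (m≤m+n ℓ (toℕ j))

  rank-injective : ∀ {a b} → rank a ≡ rank b → a ≡ b
  rank-injective {inj₁ i} {inj₁ j} e = cong inj₁ (toℕ-injective e)
  rank-injective {inj₁ i} {inj₂ j} e = ⊥-elim (<-irrefl e (unprimed<primed i j))
  rank-injective {inj₂ i} {inj₁ j} e = ⊥-elim (<-irrefl (sym e) (unprimed<primed j i))
  rank-injective {inj₂ i} {inj₂ j} e = cong inj₂ (toℕ-injective (+-cancelˡ-≡ ℓ _ _ e))

  compareL : ∀ a b → Trichotomyᵇ (rank a) (rank b) (a <L b) (a =L b)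
  compareL (inj₁ i) (inj₁ j) = compareᵇ (toℕ i) (toℕ j)
  compareL (inj₁ i) (inj₂ j) = lt (unprimed<primed i j)
  compareL (inj₂ i) (inj₁ j) = gt (unprimed<primed j i)
  compareL (inj₂ i) (inj₂ j) = trichotomyᵇ-+ˡ ℓ (compareᵇ (toℕ i) (toℕ j))

  Cell : Set
  Cell = Letter ℓ k × ℕ

  -- A cell (a , r) is the letter a in row r (row 0 at the bottom).  _⊏_ holds between
  -- consecutive cells of an admissible reading: letters weakly increase, a repeated unprimed
  -- letter does not move up, a repeated primed letter moves up.  _⊑_ is the total order in which
  -- a hook tableau is read.
  data HookOrder (_≺_ : ℕ → ℕ → Set) : Cell → Cell → Set where
    rank<     : ∀ {a b r s} → rank a < rank b → HookOrder _≺_ (a , r) (b , s)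
    unprimed≥ : ∀ {a r s} → unprimed a ≡ true → s ≤ r → HookOrder _≺_ (a , r) (a , s)
    primed≺   : ∀ {a r s} → unprimed a ≡ false → r ≺ s → HookOrder _≺_ (a , r) (a , s)

  _⊏_ _⊑_ : Cell → Cell → Set
  _⊏_ = HookOrder _<_
  _⊑_ = HookOrder _≤_

  ⊏⇒⊑ : ∀ {p q} → p ⊏ q → p ⊑ q
  ⊏⇒⊑ (rank< a<b)      = rank< a<b
  ⊏⇒⊑ (unprimed≥ u s≤r) = unprimed≥ u s≤r
  ⊏⇒⊑ (primed≺ u r<s)  = primed≺ u (<⇒≤ r<s)

  hookOrder-trans : ∀ {_≺_} → (∀ {i j l} → i ≺ j → j ≺ l → i ≺ l) →
                    ∀ {p q u} → HookOrder _≺_ p q → HookOrder _≺_ q u → HookOrder _≺_ p u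
  hookOrder-trans ≺-trans (rank< a<b)    (rank< b<c)    = rank< (<-trans a<b b<c)
  hookOrder-trans ≺-trans (rank< a<b)    (unprimed≥ _ _) = rank< a<b
  hookOrder-trans ≺-trans (rank< a<b)    (primed≺ _ _)  = rank< a<b
  hookOrder-trans ≺-trans (unprimed≥ _ _) (rank< a<b)    = rank< a<b
  hookOrder-trans ≺-trans (primed≺ _ _)  (rank< a<b)    = rank< a<b
  hookOrder-trans ≺-trans (unprimed≥ u s≤r) (unprimed≥ _ t≤s) = unprimed≥ u (≤-trans t≤s s≤r)
  hookOrder-trans ≺-trans (unprimed≥ u _) (primed≺ u′ _) = ⊥-elim (true≢false (trans (sym u) u′))
  hookOrder-trans ≺-trans (primed≺ u _)  (unprimed≥ u′ _) = ⊥-elim (true≢false (trans (sym u′) u))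
  hookOrder-trans ≺-trans (primed≺ u r≺s) (primed≺ _ s≺t) = primed≺ u (≺-trans r≺s s≺t)

  ⊏-trans : ∀ {p q u} → p ⊏ q → q ⊏ u → p ⊏ u
  ⊏-trans = hookOrder-trans <-trans

  ⊑-trans : ∀ {p q u} → p ⊑ q → q ⊑ u → p ⊑ u
  ⊑-trans = hookOrder-trans ≤-trans

  ⊑-refl : ∀ {p} → p ⊑ p
  ⊑-refl {a , r} with unprimed a in u
  ... | true  = unprimed≥ u ≤-refl
  ... | false = primed≺ u ≤-refl

  ⊑-antisym : ∀ {p q} → p ⊑ q → q ⊑ p → p ≡ q
  ⊑-antisym (rank< a<b)      (rank< b<a)      = ⊥-elim (<-asym a<b b<a)
  ⊑-antisym (rank< a<a)      (unprimed≥ _ _)   = ⊥-elim (<-irrefl refl a<a)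
  ⊑-antisym (rank< a<a)      (primed≺ _ _)    = ⊥-elim (<-irrefl refl a<a)
  ⊑-antisym (unprimed≥ _ _)   (rank< a<a)      = ⊥-elim (<-irrefl refl a<a)
  ⊑-antisym (primed≺ _ _)    (rank< a<a)      = ⊥-elim (<-irrefl refl a<a)
  ⊑-antisym (unprimed≥ _ s≤r) (unprimed≥ _ r≤s) = cong (_ ,_) (≤-antisym r≤s s≤r)
  ⊑-antisym (unprimed≥ u _)   (primed≺ u′ _)   = ⊥-elim (true≢false (trans (sym u) u′))
  ⊑-antisym (primed≺ u _)    (unprimed≥ u′ _)  = ⊥-elim (true≢false (trans (sym u′) u))
  ⊑-antisym (primed≺ _ r≤s)  (primed≺ _ s≤r)  = cong (_ ,_) (≤-antisym r≤s s≤r)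

  ⊑-total : ∀ p q → p ⊑ q ⊎ q ⊑ p
  ⊑-total (a , r) (b , s) with <-cmp (rank a) (rank b)
  ... | tri< a<b _ _ = inj₁ (rank< a<b)
  ... | tri> _ _ b<a = inj₂ (rank< b<a)
  ... | tri≈ _ a≡b _ with refl ← rank-injective {a} {b} a≡b with unprimed a in u | ≤-total r s
  ... | true  | inj₁ r≤s = inj₂ (unprimed≥ u r≤s)
  ... | true  | inj₂ s≤r = inj₁ (unprimed≥ u s≤r)
  ... | false | inj₁ r≤s = inj₁ (primed≺ u r≤s)
  ... | false | inj₂ s≤r = inj₂ (primed≺ u s≤r)

  sameLetter-⊑? : ∀ a r s → Dec ((a , r) ⊑ (a , s))
  sameLetter-⊑? a r s with unprimed a in u
  ... | true with s ≤? r
  ...   | yes s≤r = yes (unprimed≥ u s≤r)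
  ...   | no s≰r  = no λ { (rank< a<a) → <-irrefl refl a<a ; (unprimed≥ _ s≤r) → s≰r s≤r
                         ; (primed≺ u′ _) → true≢false (trans (sym u) u′) }
  sameLetter-⊑? a r s | false with r ≤? s
  ...   | yes r≤s = yes (primed≺ u r≤s)
  ...   | no r≰s  = no λ { (rank< a<a) → <-irrefl refl a<a ; (unprimed≥ u′ _) → true≢false (trans (sym u′) u)
                         ; (primed≺ _ r≤s) → r≰s r≤s }

  _⊑?_ : ∀ p q → Dec (p ⊑ q)
  (a , r) ⊑? (b , s) with <-cmp (rank a) (rank b)
  ... | tri< a<b _ _ = yes (rank< a<b)
  ... | tri> _ a≢b b<a = no λ { (rank< a<b) → <-asym a<b b<a ; (unprimed≥ _ _) → a≢b refl ; (primed≺ _ _) → a≢b refl }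
  ... | tri≈ _ a≡b _ with refl ← rank-injective {a} {b} a≡b = sameLetter-⊑? a r s

  ⊑-isTotalOrder : IsTotalOrder _≡_ _⊑_
  ⊑-isTotalOrder = record
    { isPartialOrder = record
      { isPreorder = record { isEquivalence = ≡.isEquivalence ; reflexive = λ { refl → ⊑-refl } ; trans = ⊑-trans }
      ; antisym    = ⊑-antisym }
    ; total = ⊑-total }

  ⊑-decTotalOrder : DecTotalOrder 0ℓ 0ℓ 0ℓ
  ⊑-decTotalOrder = record
    { isDecTotalOrder = record
      { isTotalOrder = ⊑-isTotalOrder
      ; _≟_          = ×.≡-dec (⊎.≡-dec Fin._≟_ Fin._≟_) ℕ._≟_
      ; _≤?_         = _⊑?_ } }

  ⊑-inRow-isTotalOrder : ∀ r → IsTotalOrder _≡_ (λ a b → (a , r) ⊑ (b , r))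
  ⊑-inRow-isTotalOrder r = record
    { isPartialOrder = record
      { isPreorder = record { isEquivalence = ≡.isEquivalence ; reflexive = λ { refl → ⊑-refl } ; trans = ⊑-trans }
      ; antisym    = λ a⊑b b⊑a → cong proj₁ (⊑-antisym a⊑b b⊑a) }
    ; total = λ a b → ⊑-total (a , r) (b , r) }

  NoRepeatedPrimed : Cell → Cell → Set
  NoRepeatedPrimed p q = p ≡ q → unprimed (proj₁ p) ≡ true

  ⊏-refl⇒unprimed : ∀ {p} → p ⊏ p → unprimed (proj₁ p) ≡ true
  ⊏-refl⇒unprimed (rank< a<a)     = ⊥-elim (<-irrefl refl a<a)
  ⊏-refl⇒unprimed (unprimed≥ u _) = u
  ⊏-refl⇒unprimed (primed≺ _ r<r) = ⊥-elim (<-irrefl refl r<r)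

  ⊑⇒⊏ : ∀ {p q} → p ⊑ q → NoRepeatedPrimed p q → p ⊏ q
  ⊑⇒⊏ (rank< a<b)       _ = rank< a<b
  ⊑⇒⊏ (unprimed≥ u s≤r) _ = unprimed≥ u s≤r
  ⊑⇒⊏ (primed≺ u r≤s)   unprimed with m≤n⇒m<n∨m≡n r≤s
  ... | inj₁ r<s  = primed≺ u r<s
  ... | inj₂ refl = ⊥-elim (true≢false (trans (sym (unprimed refl)) u))

  rowOK⇒⊏ : ∀ {a b} r → rowOK a b ≡ true → (a , r) ⊏ (b , r)
  rowOK⇒⊏ {a} {b} r ok with a <L b | a =L b | compareL a b
  ... | _ | _ | lt a<b = rank< a<b
  ... | _ | _ | eq a≡b with refl ← rank-injective {a} {b} a≡b = unprimed≥ ok ≤-refl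

  ⊏⇒rowOK : ∀ {a b r} → (a , r) ⊏ (b , r) → rowOK a b ≡ true
  ⊏⇒rowOK {a} {b} a⊏b with a <L b | a =L b | compareL a b | a⊏b
  ... | _ | _ | lt _   | _               = refl
  ... | _ | _ | eq a≡b | rank< a<b       = ⊥-elim (<-irrefl a≡b a<b)
  ... | _ | _ | eq _   | unprimed≥ u _   = u
  ... | _ | _ | eq _   | primed≺ _ r<r   = ⊥-elim (<-irrefl refl r<r)
  ... | _ | _ | gt b<a | rank< a<b       = ⊥-elim (<-asym a<b b<a)
  ... | _ | _ | gt a<a | unprimed≥ _ _   = ⊥-elim (<-irrefl refl a<a)
  ... | _ | _ | gt a<a | primed≺ _ _     = ⊥-elim (<-irrefl refl a<a)

  colOK⇒⊏ : ∀ {a b} r → colOK a b ≡ true → (a , r) ⊏ (b , suc r)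
  colOK⇒⊏ {a} {b} r ok with a <L b | a =L b | compareL a b
  ... | _ | _ | lt a<b = rank< a<b
  ... | _ | _ | eq a≡b with refl ← rank-injective {a} {b} a≡b with unprimed a in u
  ...   | false = primed≺ u ≤-refl

  ⊏⇒colOK : ∀ {a b r} → (a , r) ⊏ (b , suc r) → colOK a b ≡ true
  ⊏⇒colOK {a} {b} a⊏b with a <L b | a =L b | compareL a b | a⊏b
  ... | _ | _ | lt _   | _               = refl
  ... | _ | _ | eq a≡b | rank< a<b       = ⊥-elim (<-irrefl a≡b a<b)
  ... | _ | _ | eq _   | unprimed≥ _ r<r = ⊥-elim (<-irrefl refl r<r)
  ... | _ | _ | eq _   | primed≺ u _     = cong not u
  ... | _ | _ | gt b<a | rank< a<b       = ⊥-elim (<-asym a<b b<a)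
  ... | _ | _ | gt a<a | unprimed≥ _ _   = ⊥-elim (<-irrefl refl a<a)
  ... | _ | _ | gt a<a | primed≺ _ _     = ⊥-elim (<-irrefl refl a<a)

  -- qCond D i (a ∷ b ∷ w) unfolds to stepCond a b (memℕ i D) (qCond D (suc i) (b ∷ w)).
  stepCond : Letter ℓ k → Letter ℓ k → Bool → Bool → Bool
  stepCond a b descent rest =
    (a ≤L b) ∧ not ((a =L b) ∧ unprimed a ∧ descent) ∧ not ((a =L b) ∧ primed a ∧ not descent) ∧ rest

  stepCond⇒⊏ : ∀ {a b} r s {rest} → stepCond a b (r <ᵇ s) rest ≡ true → (a , r) ⊏ (b , s) × rest ≡ true
  stepCond⇒⊏ {a} {b} r s ok with a <L b | a =L b | compareL a b
  ... | _ | _ | lt a<b = rank< a<b , ok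
  ... | _ | _ | eq a≡b with refl ← rank-injective {a} {b} a≡b
                       with unprimed a in u | r <ᵇ s | r ≡ᵇ s | compareᵇ r s
  ...   | true  | _ | _ | eq r≡s = unprimed≥ u (≤-reflexive (sym r≡s)) , ok
  ...   | true  | _ | _ | gt s<r = unprimed≥ u (<⇒≤ s<r) , ok
  ...   | false | _ | _ | lt r<s = primed≺ u r<s , ok

  ⊏⇒stepCond : ∀ {a b r s rest} → (a , r) ⊏ (b , s) → rest ≡ true → stepCond a b (r <ᵇ s) rest ≡ true
  ⊏⇒stepCond {a} {b} {r} {s} a⊏b ok with a <L b | a =L b | compareL a b | a⊏b
  ... | _ | _ | lt _   | _               = ok
  ... | _ | _ | eq a≡b | rank< a<b       = ⊥-elim (<-irrefl a≡b a<b)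
  ... | _ | _ | eq _   | unprimed≥ u s≤r rewrite u | ≤⇒<ᵇ≡false s≤r = ok
  ... | _ | _ | eq _   | primed≺ u r<s rewrite u | <⇒<ᵇ≡true r<s = ok
  ... | _ | _ | gt b<a | rank< a<b       = ⊥-elim (<-asym a<b b<a)
  ... | _ | _ | gt a<a | unprimed≥ _ _   = ⊥-elim (<-irrefl refl a<a)
  ... | _ | _ | gt a<a | primed≺ _ _     = ⊥-elim (<-irrefl refl a<a)

-- Compositions and Q̃-admissible words

∸-telescope : ∀ {p d n} → p ≤ d → d ≤ n → (d ∸ p) + (n ∸ d) ≡ n ∸ p
∸-telescope {p} {d} {n} p≤d d≤n = begin
  (d ∸ p) + (n ∸ d)   ≡⟨ +-comm (d ∸ p) (n ∸ d) ⟩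
  (n ∸ d) + (d ∸ p)   ≡⟨ +-∸-assoc (n ∸ d) p≤d ⟨
  (n ∸ d + d) ∸ p     ≡⟨ cong (_∸ p) (m∸n+n≡m d≤n) ⟩
  n ∸ p               ∎
  where open ≡.≡-Reasoning

sum-compAux : ∀ n prev D → prev ≤ n → Linked _≤_ (prev ∷ D) → All (_≤ n) D → sum (compAux n prev D) ≡ n ∸ prev
sum-compAux n prev []      _      _               _          = +-identityʳ (n ∸ prev)
sum-compAux n prev (d ∷ D) prev≤n (prev≤d ∷ D↗) (d≤n ∷ D≤n) =
  trans (cong ((d ∸ prev) +_) (sum-compAux n d D d≤n D↗ D≤n)) (∸-telescope prev≤d d≤n)

partialSums-compAux : ∀ n prev D → Linked _≤_ (prev ∷ D) → partialSums prev (compAux n prev D) ≡ D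
partialSums-compAux n prev []           _                 = refl
partialSums-compAux n prev (d ∷ [])     (prev≤d ∷ _)      = cong (_∷ []) (m+[n∸m]≡n prev≤d)
partialSums-compAux n prev (d ∷ d′ ∷ D) (prev≤d ∷ D↗) rewrite m+[n∸m]≡n prev≤d =
  cong (d ∷_) (partialSums-compAux n d (d′ ∷ D) D↗)

descents : (ℕ → ℕ) → ℕ → List ℕ
descents g n = filter (λ i → (g i <ᵇ g (suc i)) Bool.≟ true) (oneTo (n ∸ 1))

module _ (g : ℕ → ℕ) (n : ℕ) where

  private
    D = descents g n

    D↗ : AllPairs _<_ D
    D↗ = AllPairs.filter⁺ _ (oneTo-↗ (n ∸ 1))

    D-bounds : ∀ {d} → d ∈ D → 1 ≤ d × d ≤ n
    D-bounds d∈ with ∈-oneTo⁻ (proj₁ (∈-filter⁻ _ {xs = oneTo (n ∸ 1)} d∈))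
    ... | 1≤d , d≤n∸1 = 1≤d , ≤-trans d≤n∸1 (m∸n≤m n 1)

    0∷D↗ : Linked _≤_ (0 ∷ D)
    0∷D↗ = Linked.AllPairs⇒Linked (All.tabulate (λ _ → z≤n) ∷ AllPairs.map <⇒≤ D↗)

  sum-comp-descents : sum (comp n D) ≡ n
  sum-comp-descents = sum-compAux n 0 D z≤n 0∷D↗ (All.tabulate (proj₂ ∘ D-bounds))

  setC-comp-descents : setC (comp n D) ≡ D
  setC-comp-descents = partialSums-compAux n 0 D 0∷D↗

  memℕ-descents : ∀ {j} → suc j < n → memℕ (suc j) D ≡ (g (suc j) <ᵇ g (suc (suc j)))
  memℕ-descents 1+j<n = memℕ-filter (λ i → g i <ᵇ g (suc i)) (∈-oneTo⁺ (s≤s z≤n) (<⇒≤∸1 1+j<n))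
    where
    <⇒≤∸1 : ∀ {m n} → m < n → m ≤ n ∸ 1
    <⇒≤∸1 {n = suc n} (s≤s m≤n) = m≤n

module _ {ℓ k : ℕ} where

  tagged : (ℕ → ℕ) → List (Letter ℓ k) → List (Cell {ℓ} {k})
  tagged ρ []      = []
  tagged ρ (a ∷ w) = (a , ρ 0) ∷ tagged (ρ ∘ suc) w

  tagged≡zip : ∀ ρ w → tagged ρ w ≡ zip w (applyUpTo ρ (length w))
  tagged≡zip ρ []      = refl
  tagged≡zip ρ (a ∷ w) = cong ((a , ρ 0) ∷_) (tagged≡zip (ρ ∘ suc) w)

DescentsFrom : List ℕ → ℕ → (ℕ → ℕ) → ℕ → Set
DescentsFrom D i ρ len = ∀ {j} → suc j < len → memℕ (j + i) D ≡ (ρ j <ᵇ ρ (suc j))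

descentsFrom-tail : ∀ {D i ρ len} → DescentsFrom D i ρ (suc len) → DescentsFrom D (suc i) (ρ ∘ suc) len
descentsFrom-tail {D} {i} desc {j} 1+j<len rewrite +-suc j i = desc (s<s 1+j<len)

module Admissible {c ℓ′ : Level} (𝓡 : CommutativeSemiring c ℓ′) {ℓ k : ℕ}
                  (x : Fin ℓ → CommutativeSemiring.Carrier 𝓡) (y : Fin k → CommutativeSemiring.Carrier 𝓡) where
  open Poly 𝓡 using (qCond)

  qCond⇒Linked : ∀ D i ρ w → DescentsFrom D i ρ (length w) → qCond x y D i w ≡ true → Linked _⊏_ (tagged ρ w)
  qCond⇒Linked D i ρ []          _    _  = []
  qCond⇒Linked D i ρ (a ∷ [])    _    _  = [-]
  qCond⇒Linked D i ρ (a ∷ b ∷ w) desc ok =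
    let a⊏b , rest = stepCond⇒⊏ (ρ 0) (ρ 1) (subst (λ d → stepCond a b d (qCond x y D (suc i) (b ∷ w)) ≡ true)
                                                   (desc (s<s z<s)) ok)
    in a⊏b ∷ qCond⇒Linked D (suc i) (ρ ∘ suc) (b ∷ w) (descentsFrom-tail {D} {i} {ρ} desc) rest

  Linked⇒qCond : ∀ D i ρ w → DescentsFrom D i ρ (length w) → Linked _⊏_ (tagged ρ w) → qCond x y D i w ≡ true
  Linked⇒qCond D i ρ []          _    _            = refl
  Linked⇒qCond D i ρ (a ∷ [])    _    _            = refl
  Linked⇒qCond D i ρ (a ∷ b ∷ w) desc (a⊏b ∷ rest) =
    subst (λ d → stepCond a b d (qCond x y D (suc i) (b ∷ w)) ≡ true) (sym (desc (s<s z<s)))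
      (⊏⇒stepCond a⊏b (Linked⇒qCond D (suc i) (ρ ∘ suc) (b ∷ w) (descentsFrom-tail {D} {i} {ρ} desc) rest))

  admissible? : ∀ β (w : List (Letter ℓ k)) → Dec (qCond x y (setC β) 1 w ≡ true)
  admissible? β w = qCond x y (setC β) 1 w Bool.≟ true

  admissibleWords : (ℕ → ℕ) → ℕ → List (List (Letter ℓ k))
  admissibleWords g n =
    filter (admissible? (comp n (descents g n))) (words (allLetters ℓ k) (sum (comp n (descents g n))))

  private
    descentsFrom-descents : ∀ g n (w : List (Letter ℓ k)) → length w ≡ n →
                            DescentsFrom (descents g n) 1 (g ∘ suc) (length w)
    descentsFrom-descents g n w refl {j} 1+j<n rewrite +-comm j 1 = memℕ-descents g (length w) 1+j<n

    tagged-oneTo : ∀ g n (w : List (Letter ℓ k)) → length w ≡ n → tagged (g ∘ suc) w ≡ zip w (map g (oneTo n))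
    tagged-oneTo g n w refl = trans (tagged≡zip (g ∘ suc) w)
      (cong (zip w) (sym (trans (cong (map g) (oneTo≡applyUpTo (length w))) (map-applyUpTo suc g (length w)))))

  ∈-admissibleWords⁻ : ∀ g n {w} → w ∈ admissibleWords g n → length w ≡ n × Linked _⊏_ (zip w (map g (oneTo n)))
  ∈-admissibleWords⁻ g n {w} w∈ = len , subst (Linked _⊏_) (tagged-oneTo g n w len)
      (qCond⇒Linked (descents g n) 1 (g ∘ suc) w (descentsFrom-descents g n w len)
                    (subst (λ D → qCond x y D 1 w ≡ true) (setC-comp-descents g n) (proj₂ filtered)))
    where
    β = comp n (descents g n)
    filtered = ∈-filter⁻ (admissible? β) {xs = words (allLetters ℓ k) (sum β)} w∈
    len : length w ≡ n
    len = trans (proj₁ (∈-words⁻ (allLetters ℓ k) (sum β) (proj₁ filtered))) (sum-comp-descents g n)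

  ∈-admissibleWords⁺ : ∀ g n {w} → length w ≡ n → Linked _⊏_ (zip w (map g (oneTo n))) → w ∈ admissibleWords g n
  ∈-admissibleWords⁺ g n {w} len chain = ∈-filter⁺ (admissible? (comp n (descents g n)))
    (∈-words⁺ (allLetters ℓ k) _ (trans len (sym (sum-comp-descents g n))) (All.tabulate λ {a} _ → ∈-allLetters a))
    (subst (λ D → qCond x y D 1 w ≡ true) (sym (setC-comp-descents g n))
       (Linked⇒qCond (descents g n) 1 (g ∘ suc) w (descentsFrom-descents g n w len)
                     (subst (Linked _⊏_) (sym (tagged-oneTo g n w len)) chain)))

-- Standard immaculate tableaux as row words

module StandardTableaux (α : List ℕ) (pos : Positive α) where

  n m : ℕ
  n = sum α
  m = length α

  idx : List ℕ
  idx = oneTo n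

  rowWord : List (List ℕ) → List ℕ
  rowWord S = map (λ i → rowOf i S) idx

  -- ρ lists the rows (0 at the bottom) of 1, …, n; `firsts` says that the first column increases.
  record StandardRowWord (ρ : List ℕ) : Set where
    field
      length≡ : length ρ ≡ n
      rows<   : All (_< m) ρ
      counts  : applyUpTo (λ r → count r ρ) m ≡ α
      firsts  : ∀ {r} → suc r < m → FirstBefore r (suc r) ρ

  standard? : ∀ S → Dec (isStandardImmaculate n S ≡ true)
  standard? S = isStandardImmaculate n S Bool.≟ true

  module FromStandard {S} (S∈ : S ∈ standardImmaculateTableaux α) where

    private
      filtered = ∈-filter⁻ standard? {xs = fillings idx α} S∈
      conditions = ∧-true⁻ {allB (λ v → count v (concat S) ≡ᵇ 1) idx} (proj₂ filtered)
      column-rows = ∧-true⁻ {consecutive _<ᵇ_ (firstColumn S)} (proj₂ conditions)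

    shape : map length S ≡ α
    shape = proj₁ (∈-fillings⁻ idx α (proj₁ filtered))

    length≡m : length S ≡ m
    length≡m = trans (sym (length-map length S)) (cong length shape)

    ∈-idx : ∀ {v r} → v ∈ nthRow r S → v ∈ idx
    ∈-idx {r = r} v∈ = All.lookup (All-nthRow (proj₂ (∈-fillings⁻ idx α (proj₁ filtered))) [] r) v∈

    once : ∀ {v} → v ∈ idx → count v (concat S) ≡ 1
    once v∈ = ≡ᵇ≡true⇒≡ (All.lookup (allB⇒All _ idx (proj₁ conditions)) v∈)

    column↗ : Linked (λ i j → (i <ᵇ j) ≡ true) (firstColumn S)
    column↗ = consecutive⇒Linked _<ᵇ_ (firstColumn S) (proj₁ column-rows)

    row↗ : ∀ r → AllPairs _<_ (nthRow r S)
    row↗ r = Linked.Linked⇒AllPairs <-trans (Linked.map <ᵇ≡true⇒<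
               (consecutive⇒Linked _<ᵇ_ _ (All-nthRow (allB⇒All _ S (proj₂ column-rows)) refl r)))

    rowOf-∈ : ∀ {v r} → v ∈ nthRow r S → rowOf v S ≡ r
    rowOf-∈ {v} {r} v∈ = rowOf-≡ v S r v∈ λ r′<r v∈′ → <-irrefl (count≡1⇒unique-row S (once (∈-idx v∈)) v∈′ v∈) r′<r

    ∈-someRow : ∀ {v} → v ∈ idx → ∃[ r ] (r < m × v ∈ nthRow r S)
    ∈-someRow v∈ with ∈-concat⇒∈-nthRow S (count>0⇒∈ (subst (0 <_) (sym (once v∈)) z<s))
    ... | r , r<len , v∈r = r , subst (r <_) length≡m r<len , v∈r

    biword : List (ℕ × ℕ)
    biword = zip idx (rowWord S)

    length-rowWord : length (rowWord S) ≡ n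
    length-rowWord = trans (length-map _ idx) (length-oneTo n)

    map-proj₂-biword : map proj₂ biword ≡ rowWord S
    map-proj₂-biword = map-proj₂-zip idx (rowWord S) (trans (length-oneTo n) (sym length-rowWord))

    biword↗ : AllPairs (_<_ on proj₁) biword
    biword↗ = zip-AllPairs (oneTo-↗ n)

    nthRow≡rowEntries : ∀ r → nthRow r S ≡ rowEntries r biword
    nthRow≡rowEntries r = ↗-sameMembers⇒≡ (row↗ r) (rowEntries-AllPairs r biword↗) ⊆ ⊇
      where
      ⊆ : ∀ {z} → z ∈ nthRow r S → z ∈ rowEntries r biword
      ⊆ z∈ = ∈-rowEntries⁺ (subst (λ t → (_ , t) ∈ biword) (rowOf-∈ z∈) (∈-zip-map⁺ _ (∈-idx z∈)))
      ⊇ : ∀ {z} → z ∈ rowEntries r biword → z ∈ nthRow r S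
      ⊇ z∈ with ∈-zip-map⁻ _ (∈-rowEntries⁻ {b = biword} z∈)
      ... | z∈idx , refl with ∈-someRow z∈idx
      ...   | r′ , _ , z∈r′ = subst (λ t → _ ∈ nthRow t S) (sym (rowOf-∈ z∈r′)) z∈r′

    S≡toTableau : S ≡ toTableau m biword
    S≡toTableau = trans (≡applyUpTo-nthRow S)
      (trans (cong (applyUpTo (λ r → nthRow r S)) length≡m) (applyUpTo-cong m λ {r} _ → nthRow≡rowEntries r))

    firsts : ∀ {r} → suc r < m → FirstBefore r (suc r) (rowWord S)
    firsts {r} 1+r<m = subst (FirstBefore r (suc r)) map-proj₂-biword
      (minimal⇒firstBefore (λ i<j j<i → ⊥-elim (<-asym i<j j<i)) (<⇒≢ (n<1+n r)) biword biword↗ y∈ y<)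
      where
      nonEmpty = nonEmpty-rows shape pos
      head-r  = nonEmpty-nthRow nonEmpty (subst (r <_) (sym length≡m) (<⇒≤ 1+r<m))
      head-r′ = nonEmpty-nthRow nonEmpty (subst (suc r <_) (sym length≡m) 1+r<m)
      y  = proj₁ head-r
      y′ = proj₁ head-r′
      y∈ : (y , r) ∈ biword
      y∈ = ∈-rowEntries⁻ (subst (y ∈_) (nthRow≡rowEntries r) (head-∈ (proj₂ head-r)))
      y<y′ : y < y′
      y<y′ = <ᵇ≡true⇒< (Linked-firstColumn S nonEmpty column↗ r (proj₂ head-r) (proj₂ head-r′))
      y< : ∀ {z} → (z , suc r) ∈ biword → y < z
      y< z∈ with head-AllPairs (row↗ (suc r)) (proj₂ head-r′)
                   (subst (_ ∈_) (sym (nthRow≡rowEntries (suc r))) (∈-rowEntries⁺ z∈))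
      ... | inj₁ refl = y<y′
      ... | inj₂ y′<z = <-trans y<y′ y′<z

    standardRowWord : StandardRowWord (rowWord S)
    standardRowWord = record
      { length≡ = length-rowWord
      ; rows<   = All.map⁺ (All.tabulate λ v∈ → let r , r<m , v∈r = ∈-someRow v∈ in
                                                 subst (_< m) (sym (rowOf-∈ v∈r)) r<m)
      ; counts  = begin
          applyUpTo (λ r → count r (rowWord S)) m         ≡⟨ cong (λ ρ → applyUpTo (λ r → count r ρ) m) map-proj₂-biword ⟨
          applyUpTo (λ r → count r (map proj₂ biword)) m  ≡⟨ shape-toTableau m biword ⟨
          map length (toTableau m biword)                 ≡⟨ cong (map length) S≡toTableau ⟨
          map length S                                    ≡⟨ shape ⟩
          α                                               ∎
      ; firsts  = firsts
      }
      where open ≡.≡-Reasoning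

  module FromRowWord {ρ} (ρ-standard : StandardRowWord ρ) where
    open StandardRowWord ρ-standard

    biword : List (ℕ × ℕ)
    biword = zip idx ρ

    map-proj₁-biword : map proj₁ biword ≡ idx
    map-proj₁-biword = map-proj₁-zip idx ρ (trans (length-oneTo n) (sym length≡))

    map-proj₂-biword : map proj₂ biword ≡ ρ
    map-proj₂-biword = map-proj₂-zip idx ρ (trans (length-oneTo n) (sym length≡))

    biword↗ : AllPairs (_<_ on proj₁) biword
    biword↗ = zip-AllPairs (oneTo-↗ n)

    biword< : All (λ p → proj₂ p < m) biword
    biword< = All.tabulate (All.lookup rows< ∘ ∈-zip⇒∈ʳ)

    S : List (List ℕ)
    S = toTableau m biword

    shape : map length S ≡ α
    shape = trans (shape-toTableau m biword)
                  (trans (cong (λ ρ → applyUpTo (λ r → count r ρ) m) map-proj₂-biword) counts)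

    S∈fillings : S ∈ fillings idx α
    S∈fillings = ∈-fillings⁺ idx α shape
      (All.applyUpTo⁺₁ _ m λ _ → All.tabulate λ z∈ → ∈-zip⇒∈ˡ (∈-rowEntries⁻ {b = biword} z∈))

    once : ∀ {v} → v ∈ idx → count v (concat S) ≡ 1
    once {v} v∈ = trans (count-↭ v (↭-trans (concat-toTableau-↭ m biword biword<) (↭-reflexive map-proj₁-biword)))
                        (count-unique (↗⇒unique (oneTo-↗ n)) v∈)

    S-standard : isStandardImmaculate n S ≡ true
    S-standard = ∧-true⁺ (All⇒allB _ (All.tabulate λ v∈ → cong (_≡ᵇ 1) (once v∈)))
                 (∧-true⁺ (Linked⇒consecutive _<ᵇ_ (firstColumn-Linked S (nonEmpty-rows shape pos)
                             (toTableau-HeadsLinked m biword biword↗ (subst (FirstBefore _ _) (sym map-proj₂-biword) ∘ firsts)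
                                                    <⇒<ᵇ≡true)))
                          (All⇒allB _ (All.applyUpTo⁺₁ _ m λ {r} _ → Linked⇒consecutive _<ᵇ_
                             (Linked.map <⇒<ᵇ≡true (Linked.AllPairs⇒Linked (rowEntries-AllPairs r biword↗))))))

    S∈ : S ∈ standardImmaculateTableaux α
    S∈ = ∈-filter⁺ standard? S∈fillings S-standard

    rowWord-S : rowWord S ≡ ρ
    rowWord-S = begin
      map (λ i → rowOf i S) idx                  ≡⟨ cong (map (λ i → rowOf i S)) map-proj₁-biword ⟨
      map (λ i → rowOf i S) (map proj₁ biword)   ≡⟨ map-proj₁-graph (λ i → rowOf i S) biword rowOf-biword ⟩
      map proj₂ biword                           ≡⟨ map-proj₂-biword ⟩
      ρ                                          ∎
      where
      open ≡.≡-Reasoning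
      rowOf-biword : ∀ {p} → p ∈ biword → rowOf (proj₁ p) S ≡ proj₂ p
      rowOf-biword p∈ = FromStandard.rowOf-∈ S∈
        (subst (_ ∈_) (sym (nthRow-toTableau biword (All.lookup biword< p∈))) (∈-rowEntries⁺ p∈))

-- Hook immaculate tableaux as biwords

module HookTableaux {ℓ k : ℕ} (α : List ℕ) (pos : Positive α) where
  open StandardTableaux α pos using (n; m; StandardRowWord)
  open import Data.List.Sort (⊑-decTotalOrder {ℓ} {k}) using (sort; sort-↭; sort-↗)

  record HookBiword (b : List (Cell {ℓ} {k})) : Set where
    field
      chain        : Linked _⊏_ b
      standardRows : StandardRowWord (map proj₂ b)

  hook? : ∀ (T : List (List (Letter ℓ k))) → Dec (isHookImmaculate T ≡ true)
  hook? T = isHookImmaculate T Bool.≟ true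

  module FromBiword {b} (hb : HookBiword b) where
    open HookBiword hb
    open StandardRowWord standardRows

    b< : All (λ p → proj₂ p < m) b
    b< = All.map⁻ rows<

    b↗ : AllPairs _⊏_ b
    b↗ = Linked.Linked⇒AllPairs ⊏-trans chain

    T : List (List (Letter ℓ k))
    T = toTableau m b

    shape : map length T ≡ α
    shape = trans (shape-toTableau m b) counts

    T∈ : T ∈ hookImmaculateTableaux ℓ k α
    T∈ = ∈-filter⁺ hook?
      (∈-fillings⁺ (allLetters ℓ k) α shape (All.tabulate λ _ → All.tabulate λ {a} _ → ∈-allLetters a))
      (∧-true⁺ (Linked⇒consecutive colOK (firstColumn-Linked T (nonEmpty-rows shape pos)
                  (toTableau-HeadsLinked m b b↗ firsts ⊏⇒colOK)))
               (All⇒allB _ (All.applyUpTo⁺₁ _ m λ {r} _ → Linked⇒consecutive rowOK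
                  (Linked.map ⊏⇒rowOK (Linked.AllPairs⇒Linked (rowEntries-AllPairs r b↗))))))

  toTableau-injective : ∀ {b b′} → HookBiword b → HookBiword b′ → toTableau m b ≡ toTableau m b′ → b ≡ b′
  toTableau-injective hb hb′ same = Linked-↭⇒≡ ⊑-isTotalOrder
    (Linked.map ⊏⇒⊑ (HookBiword.chain hb)) (Linked.map ⊏⇒⊑ (HookBiword.chain hb′))
    (toTableau-injective-↭ m (FromBiword.b< hb) (FromBiword.b< hb′) same)

  cellsFrom-noRepeatedPrimed : ∀ s (T : List (List (Letter ℓ k))) → All (Linked (λ a b → rowOK a b ≡ true)) T →
                               AllPairs NoRepeatedPrimed (cellsFrom s T)
  cellsFrom-noRepeatedPrimed s []      []           = []
  cellsFrom-noRepeatedPrimed s (R ∷ T) (R↗ ∷ T↗) =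
    AllPairs.++⁺ (AllPairs.map⁺ (AllPairs.map (λ a⊏b → λ { refl → ⊏-refl⇒unprimed a⊏b })
                                    (Linked.Linked⇒AllPairs ⊏-trans (Linked.map (rowOK⇒⊏ s) R↗))))
                 (cellsFrom-noRepeatedPrimed (suc s) T T↗)
                 (All.map⁺ (All.tabulate λ _ → All.map (λ (s<t , _) → λ { refl → ⊥-elim (<-irrefl refl s<t) })
                                                        (cellsFrom-rows (suc s) T)))

  module FromHook {T} (T∈ : T ∈ hookImmaculateTableaux ℓ k α) where

    private
      filtered   = ∈-filter⁻ hook? {xs = fillings (allLetters ℓ k) α} T∈
      conditions = ∧-true⁻ {consecutive colOK (firstColumn T)} (proj₂ filtered)

    shape : map length T ≡ α
    shape = proj₁ (∈-fillings⁻ (allLetters ℓ k) α (proj₁ filtered))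

    length≡m : length T ≡ m
    length≡m = trans (sym (length-map length T)) (cong length shape)

    nonEmpty : All NonEmpty T
    nonEmpty = nonEmpty-rows shape pos

    column : Linked (λ a b → colOK a b ≡ true) (firstColumn T)
    column = consecutive⇒Linked colOK (firstColumn T) (proj₁ conditions)

    rows : All (Linked (λ a b → rowOK a b ≡ true)) T
    rows = All.map (consecutive⇒Linked rowOK _) (allB⇒All _ T (proj₂ conditions))

    row↗ : ∀ r → AllPairs (λ a b → (a , r) ⊏ (b , r)) (nthRow r T)
    row↗ r = Linked.Linked⇒AllPairs ⊏-trans (Linked.map (rowOK⇒⊏ r) (All-nthRow rows [] r))

    b : List (Cell {ℓ} {k})
    b = sort (cells T)

    b↭ : b ↭ cells T
    b↭ = sort-↭ (cells T)

    b⊑ : AllPairs _⊑_ b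
    b⊑ = Linked.Linked⇒AllPairs ⊑-trans (sort-↗ (cells T))

    rowEntries-b : ∀ r → rowEntries r b ≡ nthRow r T
    rowEntries-b r = Linked-↭⇒≡ (⊑-inRow-isTotalOrder r)
      (Linked.AllPairs⇒Linked (rowEntries-AllPairs r b⊑)) (Linked.map ⊏⇒⊑ (Linked.AllPairs⇒Linked (row↗ r)))
      (↭-trans (rowEntries-↭ r b↭) (↭-reflexive (rowEntries-cells r T)))

    toTableau-b : toTableau m b ≡ T
    toTableau-b = sym (trans (≡applyUpTo-nthRow T)
      (trans (cong (applyUpTo (λ r → nthRow r T)) length≡m) (applyUpTo-cong m λ {r} _ → sym (rowEntries-b r))))

    chain : Linked _⊏_ b
    chain = upgrade (sort-↗ (cells T))
      (↭ₛ.AllPairs-resp-↭ (≡.setoid (Cell {ℓ} {k}))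
         (λ { p≡q refl → p≡q refl }) ((λ { refl → id }) , (λ { refl → id }))
        (↭⇒↭ₛ′ ≡.isEquivalence (↭-sym b↭)) (cellsFrom-noRepeatedPrimed 0 T rows))
      where
      upgrade : ∀ {cs} → Linked _⊑_ cs → AllPairs NoRepeatedPrimed cs → Linked _⊏_ cs
      upgrade []          _                  = []
      upgrade [-]         _                  = [-]
      upgrade (p⊑q ∷ cs⊑) ((p≠q ∷ _) ∷ cs≠) = ⊑⇒⊏ p⊑q p≠q ∷ upgrade cs⊑ cs≠

    firsts : ∀ {r} → suc r < m → FirstBefore r (suc r) (map proj₂ b)
    firsts {r} 1+r<m = minimal⇒firstBefore ⊑-antisym (<⇒≢ (n<1+n r)) b b⊑ y∈ y⊑
      where
      head-r  = nonEmpty-nthRow nonEmpty (subst (r <_) (sym length≡m) (<⇒≤ 1+r<m))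
      head-r′ = nonEmpty-nthRow nonEmpty (subst (suc r <_) (sym length≡m) 1+r<m)
      y  = proj₁ head-r
      y∈ : (y , r) ∈ b
      y∈ = ∈-rowEntries⁻ (subst (y ∈_) (sym (rowEntries-b r)) (head-∈ (proj₂ head-r)))
      y⊏y′ : (y , r) ⊏ (proj₁ head-r′ , suc r)
      y⊏y′ = colOK⇒⊏ r (Linked-firstColumn T nonEmpty column r (proj₂ head-r) (proj₂ head-r′))
      y⊑ : ∀ {z} → (z , suc r) ∈ b → (y , r) ⊑ (z , suc r)
      y⊑ z∈ with head-AllPairs (row↗ (suc r)) (proj₂ head-r′) (subst (_ ∈_) (rowEntries-b (suc r)) (∈-rowEntries⁺ z∈))
      ... | inj₁ refl   = ⊏⇒⊑ y⊏y′
      ... | inj₂ y′⊏z   = ⊏⇒⊑ (⊏-trans y⊏y′ y′⊏z)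

    hookBiword : HookBiword b
    hookBiword = record
      { chain   = chain
      ; standardRows = record
        { length≡ = trans (length-map proj₂ b) (trans (↭.↭-length b↭) (trans (length-cellsFrom 0 T) (cong sum shape)))
        ; rows<   = All.map⁺ (↭.All-resp-↭ (↭-sym b↭)
                      (subst (λ l → All (λ p → proj₂ p < l) (cells T)) length≡m (cells-rows T)))
        ; counts  = trans (sym (shape-toTableau m b)) (trans (cong (map length) toTableau-b) shape)
        ; firsts  = firsts
        }
      }

-- The bijection

module Expansion {c ℓ′ : Level} (𝓡 : CommutativeSemiring c ℓ′) {ℓ k : ℕ}
            (x : Fin ℓ → CommutativeSemiring.Carrier 𝓡) (y : Fin k → CommutativeSemiring.Carrier 𝓡)
            (α : List ℕ) (pos : Positive α) where
  open CommutativeSemiring 𝓡 using (_≈_; +-commutativeMonoid; *-commutativeMonoid)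
  open Poly 𝓡
  open Admissible 𝓡 x y
  open StandardTableaux α pos
  open HookTableaux {ℓ} {k} α pos
  module Σ = Fold +-commutativeMonoid
  module Π = Fold *-commutativeMonoid

  admissibleFor : List (List ℕ) → List (List (Letter ℓ k))
  admissibleFor S = admissibleWords (λ i → rowOf i S) n

  Ψ : List (List ℕ) → List (Letter ℓ k) → List (List (Letter ℓ k))
  Ψ S w = toTableau m (zip w (rowWord S))

  standards : List (List (List ℕ))
  standards = standardImmaculateTableaux α

  pairs : List (List (List (Letter ℓ k)))
  pairs = concatMap (λ S → map (Ψ S) (admissibleFor S)) standards

  hooks : List (List (List (Letter ℓ k)))
  hooks = hookImmaculateTableaux ℓ k α

  module Pair {S w} (S∈ : S ∈ standardImmaculateTableaux α) (w∈ : w ∈ admissibleFor S) where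
    private
      admissible = ∈-admissibleWords⁻ (λ i → rowOf i S) n w∈
      module S = FromStandard S∈

    length-w : length w ≡ length (rowWord S)
    length-w = trans (proj₁ admissible) (sym S.length-rowWord)

    biword : HookBiword (zip w (rowWord S))
    biword = record
      { chain   = proj₂ admissible
      ; standardRows = subst StandardRowWord (sym (map-proj₂-zip w (rowWord S) length-w)) S.standardRowWord }

    concat-Ψ : concat (Ψ S w) ↭ w
    concat-Ψ = ↭-trans (concat-toTableau-↭ m _ (FromBiword.b< biword))
                       (↭-reflexive (map-proj₁-zip w (rowWord S) length-w))

  Ψ-injective : ∀ {S S′ w w′} (S∈ : S ∈ standardImmaculateTableaux α) (S′∈ : S′ ∈ standardImmaculateTableaux α) →
                w ∈ admissibleFor S → w′ ∈ admissibleFor S′ → Ψ S w ≡ Ψ S′ w′ → S ≡ S′ × w ≡ w′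
  Ψ-injective {S} {S′} {w} {w′} S∈ S′∈ w∈ w′∈ same = S≡S′ , w≡w′
    where
    module P = Pair S∈ w∈
    module P′ = Pair S′∈ w′∈
    b≡b′ : zip w (rowWord S) ≡ zip w′ (rowWord S′)
    b≡b′ = toTableau-injective P.biword P′.biword same
    w≡w′ : w ≡ w′
    w≡w′ = trans (sym (map-proj₁-zip w _ P.length-w)) (trans (cong (map proj₁) b≡b′) (map-proj₁-zip w′ _ P′.length-w))
    ρ≡ρ′ : rowWord S ≡ rowWord S′
    ρ≡ρ′ = trans (sym (map-proj₂-zip w _ P.length-w)) (trans (cong (map proj₂) b≡b′) (map-proj₂-zip w′ _ P′.length-w))
    S≡S′ : S ≡ S′
    S≡S′ = trans (FromStandard.S≡toTableau S∈)
             (trans (cong (λ ρ → toTableau m (zip idx ρ)) ρ≡ρ′) (sym (FromStandard.S≡toTableau S′∈)))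

  pairs-unique : Unique pairs
  pairs-unique = unique-concatMap-map Ψ admissibleFor
    (Unique.filter⁺ standard? (fillings-unique idx (↗⇒unique (oneTo-↗ n)) α))
    (λ {S} _ → Unique.filter⁺ (admissible? (comp n (DesS n S)))
                 (words-unique (allLetters ℓ k) allLetters-unique (sum (comp n (DesS n S)))))
    Ψ-injective

  hooks-unique : Unique hooks
  hooks-unique = Unique.filter⁺ hook? (fillings-unique (allLetters ℓ k) allLetters-unique α)

  ∈-pairs⇒∈-hooks : ∀ {T} → T ∈ pairs → T ∈ hooks
  ∈-pairs⇒∈-hooks T∈ with ∈-concatMap-find (λ S → map (Ψ S) (admissibleFor S)) standards T∈
  ... | S , S∈ , ΨSw∈ with ∈-map⁻ (Ψ S) ΨSw∈
  ... | w , w∈ , refl = FromBiword.T∈ (Pair.biword S∈ w∈)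

  ∈-hooks⇒∈-pairs : ∀ {T} → T ∈ hooks → T ∈ pairs
  ∈-hooks⇒∈-pairs {T} T∈ = ∈-concatMap-lose (λ S → map (Ψ S) (admissibleFor S)) S.S∈
                              (subst (_∈ map (Ψ S.S) (admissibleFor S.S)) ΨSw≡T (∈-map⁺ (Ψ S.S) w∈))
    where
    open FromHook T∈ using (b; toTableau-b; hookBiword)
    open HookBiword hookBiword using (chain; standardRows)
    module S = FromRowWord standardRows
    w : List (Letter ℓ k)
    w = map proj₁ b
    zip-w-rowWord : zip w (rowWord S.S) ≡ b
    zip-w-rowWord = trans (cong (zip w) S.rowWord-S) (zip-map-proj b)
    w∈ : w ∈ admissibleFor S.S
    w∈ = ∈-admissibleWords⁺ _ n
           (trans (length-map proj₁ b) (trans (sym (length-map proj₂ b)) (StandardRowWord.length≡ standardRows)))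
           (subst (Linked _⊏_) (sym zip-w-rowWord) chain)
    ΨSw≡T : Ψ S.S w ≡ T
    ΨSw≡T = trans (cong (toTableau m) zip-w-rowWord) toTableau-b

  pairs↭hooks : pairs ↭ hooks
  pairs↭hooks = sameMembers⇒↭ pairs-unique hooks-unique ∈-pairs⇒∈-hooks ∈-hooks⇒∈-pairs

  Σ-image-Ψ : ∀ {S} → S ∈ standardImmaculateTableaux α →
              Σ.fold (monomial x y ∘ concat) (map (Ψ S) (admissibleFor S)) ≈ Σ.fold (monomial x y) (admissibleFor S)
  Σ-image-Ψ {S} S∈ = begin
    Σ.fold (monomial x y ∘ concat) (map (Ψ S) (admissibleFor S)) ≡⟨ foldr-map _ (Ψ S) _ (admissibleFor S) ⟩
    Σ.fold (monomial x y ∘ concat ∘ Ψ S) (admissibleFor S)       ≈⟨ Σ.fold-cong (admissibleFor S) monomial-Ψ ⟩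
    Σ.fold (monomial x y) (admissibleFor S)                      ∎
    where
    open import Relation.Binary.Reasoning.Setoid (CommutativeSemiring.setoid 𝓡)
    monomial-Ψ : ∀ {w} → w ∈ admissibleFor S → monomial x y (concat (Ψ S w)) ≈ monomial x y w
    monomial-Ψ w∈ = Π.fold-↭ (z x y) (Pair.concat-Ψ S∈ w∈)

  HS-expansion : HS x y α ≈ Σ x y (standardImmaculateTableaux α) (λ S → Qt x y (comp n (DesS n S)))
  HS-expansion = begin
    Σ.fold (monomial x y ∘ concat) hooks
      ≈⟨ Σ.fold-↭ _ pairs↭hooks ⟨
    Σ.fold (monomial x y ∘ concat) pairs
      ≈⟨ Σ.fold-concatMap _ _ standards ⟩
    Σ.fold (λ S → Σ.fold (monomial x y ∘ concat) (map (Ψ S) (admissibleFor S))) standards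
      ≈⟨ Σ.fold-cong standards Σ-image-Ψ ⟩
    Σ.fold (λ S → Σ.fold (monomial x y) (admissibleFor S)) standards
      ∎
    where open import Relation.Binary.Reasoning.Setoid (CommutativeSemiring.setoid 𝓡)

theorem5p7 : ∀ {c ℓ′ : Level} (R : CommutativeSemiring c ℓ′) (ℓ k : ℕ)
    (x : Fin ℓ → CommutativeSemiring.Carrier R)
    (y : Fin k → CommutativeSemiring.Carrier R)
    (n : ℕ) (α : List ℕ) → α ⊨ n →
    CommutativeSemiring._≈_ R (Poly.HS R x y α)
    (Poly.Σ R x y (standardImmaculateTableaux α)
    (λ S → Poly.Qt R x y (comp n (DesS n S))))
theorem5p7 R ℓ k x y _ α (pos , refl) = Expansion.HS-expansion R x y α pos
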